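{- For $n\ge2$, let $Q_1(n)=\sum_{\pi\in\mathrm{Av}_n(213)}\#\{v\in V(G_\pi):\deg(v)=1\}$, where $G_\pi$ is the grid graph of $\pi$. Then \[ Q_1(n)=(n+2)\,C_{n-1}=\frac{n+2}{2(2n-1)}\binom{2n}{n}, \] where $C_k=\frac{1}{k+1}\binom{2k}{k}$.
   Context: The grid graph $G_\pi$ of a permutation $\pi=\pi_1\cdots\pi_n$ of $[n]$ has vertex set $\{(i,j):1\le i\le n,\ 1\le j\le \pi_i\}$; two vertices $(i,j),(i',j')$ are adjacent iff either $i=i'$ and $|j-j'|=1$, or $|i-i'|=1$ and $j=j'$. $\mathrm{Av}_n(213)$ is the set of permutations of $[n]$ with no $p<q<r$ such that $\pi_q<\pi_p<\pi_r$. -}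

module Defs where

open import Data.Nat using (ℕ; zero; suc; _+_; _*_; _∸_; _≡ᵇ_; _<ᵇ_; ∣_-_∣)
open import Data.Nat.DivMod using (_/_)
open import Data.Nat.Combinatorics using (_C_)
open import Data.Bool using (Bool; true; false; _∧_; _∨_; not)
open import Data.Fin using (Fin; toℕ)
open import Data.List using (List; []; _∷_; map; concatMap; filterᵇ; length; allFin; applyUpTo)
open import Data.Bool.ListAction using (all; any)
open import Data.Nat.ListAction using (sum)
open import Data.Vec using (Vec; lookup)
  renaming ([] to []ᵥ; _∷_ to _∷ᵥ_)
open import Data.Product using (_×_; _,_)

-- A word of length n over [n]: position i : Fin n stands for position toℕ i + 1,
-- value  val w i = toℕ (lookup w i) + 1  ∈ {1,…,n}.
Word : ℕ → Set
Word n = Vec (Fin n) n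

val : ∀ {n} → Word n → Fin n → ℕ
val w i = suc (toℕ (lookup w i))

allWords : (n k : ℕ) → List (Vec (Fin n) k)
allWords n zero = []ᵥ ∷ []
allWords n (suc k) = concatMap (λ x → map (x ∷ᵥ_) (allWords n k)) (allFin n)

-- w is a permutation of [n]: injective (hence bijective, as an endomap of a finite set)
isPerm : ∀ {n} → Word n → Bool
isPerm {n} w =
  all (λ p → all (λ q → not (val w p ≡ᵇ val w q) ∨ (toℕ p ≡ᵇ toℕ q)) (allFin n)) (allFin n)

contains213 : ∀ {n} → Word n → Bool
contains213 {n} w =
  any (λ p → any (λ q → any (λ r →
      (toℕ p <ᵇ toℕ q) ∧ (toℕ q <ᵇ toℕ r) ∧ (val w q <ᵇ val w p) ∧ (val w p <ᵇ val w r))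
    (allFin n)) (allFin n)) (allFin n)

Av213 : (n : ℕ) → List (Word n)
Av213 n = filterᵇ (λ w → isPerm w ∧ not (contains213 w)) (allWords n n)

-- Grid graph G_π.  Vertices (i , j) with i the position (1-based: toℕ i + 1)
-- and 1 ≤ j ≤ π_i.
Vertex : ℕ → Set
Vertex n = Fin n × ℕ

vertices : ∀ {n} → Word n → List (Vertex n)
vertices {n} π = concatMap (λ i → applyUpTo (λ j → (i , suc j)) (val π i)) (allFin n)

adjacent : ∀ {n} → Vertex n → Vertex n → Bool
adjacent (i , j) (i' , j') =
  ((toℕ i ≡ᵇ toℕ i') ∧ (∣ j - j' ∣ ≡ᵇ 1)) ∨ ((∣ toℕ i - toℕ i' ∣ ≡ᵇ 1) ∧ (j ≡ᵇ j'))

degree : ∀ {n} → Word n → Vertex n → ℕ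
degree π v = length (filterᵇ (adjacent v) (vertices π))

leaves : ∀ {n} → Word n → ℕ
leaves π = length (filterᵇ (λ v → degree π v ≡ᵇ 1) (vertices π))

Q₁ : ℕ → ℕ
Q₁ n = sum (map leaves (Av213 n))

-- Catalan numbers C_k = (1/(k+1)) binom(2k,k)  (exact division)
catalan : ℕ → ℕ
catalan k = ((2 * k) C k) / suc k

{-# OPTIONS --safe #-}
module Submission where

open import Defs
open import Data.Nat using (ℕ; _+_; _*_; _∸_; _≥_)
open import Data.Nat.Combinatorics using (_C_)
open import Data.Product using (_×_)
open import Relation.Binary.PropositionalEquality using (_≡_)

-- Read a 213-avoiding permutation as the list of its column heights. Every π ∈ Av(n+1) arises exactly
-- once by inserting the maximum n+1 into some σ ∈ Av(n) at a position i ≤ run σ, the length of the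
-- initial increasing run of σ, and then run π = i+1. The leaves of the grid graph are the tops of
-- columns higher than both neighbours and the bottom cells of end columns of height 1, so inserting the
-- maximum at position i changes their number by [i+2 ≤ run σ], minus [σ₁ = 1] when i = 0. Refining by
-- run, the number of permutations, the number of those starting with 1 and the number of leaves satisfy
-- linear recurrences along this tree. The first is solved by ballot numbers (n, r ↦ C(2n−r−1, n−1) −
-- C(2n−r−1, n)), which gives the Catalan numbers at r = 1; the others are expressed through it, and the
-- leaf recurrence at r = 1 yields Q₁(n) = (n+2)·C_{n−1}.

open import Data.Bool using (Bool; true; false; T; _∧_; _∨_; not)
open import Data.Bool.Properties using (T-∧; T-≡; T-not-≡)
open import Data.Empty using (⊥; ⊥-elim)
open import Data.Fin using (Fin; zero; suc; toℕ; fromℕ<)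
open import Data.Fin.Properties using (toℕ-injective; toℕ<n; toℕ-fromℕ<; pigeonhole)
open import Data.List hiding (sum; insertAt; lookup; tabulate; all; any; and; or)
import Data.List as List using (tabulate)
open import Data.List.Properties using (map-++; map-∘; map-id-local; ∷-injective)
open import Data.List.Membership.Propositional using (_∈_; _∉_; lose)
open import Data.List.Membership.Propositional.Properties
  using (∈-map⁺; ∈-map⁻; ∈-++⁻; ∈-concatMap⁺; ∈-applyUpTo⁺; ∈-applyUpTo⁻; ∈-allFin;
         ∈-cartesianProductWith⁺; ∈-filter⁺; ∈-filter⁻)
open import Data.List.Membership.Propositional.Properties.WithK using (unique∧set⇒bag)
open import Data.List.Relation.Binary.BagAndSetEquality using (∼bag⇒↭)
open import Data.List.Relation.Binary.Permutation.Propositional using (_↭_)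
import Data.List.Relation.Binary.Permutation.Propositional.Properties as ↭
open import Data.List.Relation.Unary.All as All using (All; []; _∷_)
open import Data.List.Relation.Unary.All.Properties using (all⁺; all⁻)
open import Data.List.Relation.Unary.AllPairs using ([]; _∷_)
open import Data.List.Relation.Unary.Any as Any using (here; there)
open import Data.List.Relation.Unary.Any.Properties using (any⁺; any⁻)
open import Data.List.Relation.Unary.Linked using (Linked; []; [-]; _∷_)
open import Data.List.Relation.Unary.Unique.Propositional using (Unique)
import Data.List.Relation.Unary.Unique.Propositional.Properties as Unique
open import Data.Nat hiding (_≥_)
open import Data.Nat.Combinatorics using (nCk+nC[k+1]≡[n+1]C[k+1]; k>n⇒nCk≡0; nCn≡1; nC1≡n; nCk≡nC[n∸k])
open import Data.Nat.DivMod using (_/_; m*n/n≡m)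
open import Data.Nat.ListAction using (sum)
open import Data.Nat.ListAction.Properties using (sum-++; sum-↭)
open import Data.Nat.Properties
open import Data.List.Membership.DecPropositional _≟_ using (_∈?_)
open import Algebra.Properties.CommutativeSemigroup +-commutativeSemigroup using (interchange)
open import Algebra.Properties.CommutativeSemigroup *-commutativeSemigroup using () renaming (x∙yz≈y∙xz to *-left-swap)
open import Data.Nat.Tactic.RingSolver using (solve-∀)
open import Data.Product using (∃; _,_; proj₁; proj₂; map₁; uncurry)
open import Data.Sum using (_⊎_; inj₁; inj₂)
open import Data.Vec using (Vec) renaming ([] to []ᵥ; _∷_ to _∷ᵥ_)
import Data.Vec as Vec using (lookup; tabulate)
import Data.Vec.Properties as Vec using (∷-injective; lookup∘tabulate)
open import Function using (_∘_; id)
open import Function.Bundles using (mk⇔; Equivalence)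
open import Relation.Binary.Definitions using (tri<; tri≈; tri>)
open import Relation.Binary.PropositionalEquality
open import Relation.Nullary using (¬_; yes; no)

private
  variable
    A B : Set

∑ : (A → ℕ) → List A → ℕ
∑ f xs = sum (map f xs)

∑-++ : (f : A → ℕ) (xs ys : List A) → ∑ f (xs ++ ys) ≡ ∑ f xs + ∑ f ys
∑-++ f xs ys = trans (cong sum (map-++ f xs ys)) (sum-++ (map f xs) (map f ys))

∑-map : (f : B → ℕ) (g : A → B) (xs : List A) → ∑ f (map g xs) ≡ ∑ (f ∘ g) xs
∑-map f g xs = cong sum (sym (map-∘ xs))

∑-concatMap : (f : B → ℕ) (g : A → List B) (xs : List A) →
  ∑ f (concatMap g xs) ≡ ∑ (∑ f ∘ g) xs
∑-concatMap f g [] = refl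
∑-concatMap f g (x ∷ xs) =
  trans (∑-++ f (g x) (concatMap g xs)) (cong (∑ f (g x) +_) (∑-concatMap f g xs))

∑-cong : {f g : A → ℕ} (xs : List A) → (∀ {x} → x ∈ xs → f x ≡ g x) → ∑ f xs ≡ ∑ g xs
∑-cong [] f≗g = refl
∑-cong (x ∷ xs) f≗g = cong₂ _+_ (f≗g (here refl)) (∑-cong xs (f≗g ∘ there))

∑-zero : {f : A → ℕ} (xs : List A) → (∀ {x} → x ∈ xs → f x ≡ 0) → ∑ f xs ≡ 0
∑-zero [] f≡0 = refl
∑-zero (x ∷ xs) f≡0 = cong₂ _+_ (f≡0 (here refl)) (∑-zero xs (f≡0 ∘ there))

∑-+ : (f g : A → ℕ) (xs : List A) → ∑ (λ x → f x + g x) xs ≡ ∑ f xs + ∑ g xs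
∑-+ f g [] = refl
∑-+ f g (x ∷ xs) = begin
  f x + g x + ∑ (λ x → f x + g x) xs ≡⟨ cong (f x + g x +_) (∑-+ f g xs) ⟩
  f x + g x + (∑ f xs + ∑ g xs)      ≡⟨ interchange (f x) (g x) (∑ f xs) (∑ g xs) ⟩
  f x + ∑ f xs + (g x + ∑ g xs)      ∎
  where open ≡-Reasoning

∑-*ˡ : (c : ℕ) (f : A → ℕ) (xs : List A) → ∑ (λ x → c * f x) xs ≡ c * ∑ f xs
∑-*ˡ c f [] = sym (*-zeroʳ c)
∑-*ˡ c f (x ∷ xs) = trans (cong (c * f x +_) (∑-*ˡ c f xs)) (sym (*-distribˡ-+ c (f x) _))

∑-↭ : (f : A → ℕ) {xs ys : List A} → xs ↭ ys → ∑ f xs ≡ ∑ f ys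
∑-↭ f p = sum-↭ (↭.map⁺ f p)

∑-bijection : {xs : List A} {ys : List B} → Unique xs → Unique ys →
  (f : A → B) (g : B → A) →
  (∀ {x} → x ∈ xs → f x ∈ ys) → (∀ {y} → y ∈ ys → g y ∈ xs) →
  (∀ {x} → x ∈ xs → g (f x) ≡ x) → (∀ {y} → y ∈ ys → f (g y) ≡ y) →
  (h : A → ℕ) → ∑ h xs ≡ ∑ (h ∘ g) ys
∑-bijection {xs = xs} {ys} xs! ys! f g f∈ g∈ gf fg h =
  trans (∑-↭ h xs↭gys) (∑-map h g ys)
  where
  gys! : Unique (map g ys)
  gys! = Unique.map⁻ (subst Unique (sym fgys≡ys) ys!)
    where
    fgys≡ys : map f (map g ys) ≡ ys
    fgys≡ys = trans (sym (map-∘ ys)) (map-id-local (All.tabulate fg))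
  xs⊆gys : ∀ {x} → x ∈ xs → x ∈ map g ys
  xs⊆gys x∈ = subst (_∈ map g ys) (gf x∈) (∈-map⁺ g (f∈ x∈))
  gys⊆xs : ∀ {x} → x ∈ map g ys → x ∈ xs
  gys⊆xs x∈ with ∈-map⁻ g x∈
  ... | y , y∈ , refl = g∈ y∈
  xs↭gys : xs ↭ map g ys
  xs↭gys = ∼bag⇒↭ (unique∧set⇒bag xs! gys! (mk⇔ xs⊆gys gys⊆xs))

∑< : ℕ → (ℕ → ℕ) → ℕ
∑< zero f = 0
∑< (suc m) f = f 0 + ∑< m (f ∘ suc)

syntax ∑< m (λ j → e) = ∑[ j < m ] e

-- Sequences of naturals, indexed from 0

infixl 10 _!_

-- 0 past the end: this is also the height of the empty columns bordering the grid.

_!_ : List ℕ → ℕ → ℕ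
[] ! _ = 0
(x ∷ xs) ! zero = x
(x ∷ xs) ! suc p = xs ! p

insertAt : List ℕ → ℕ → ℕ → List ℕ
insertAt xs zero v = v ∷ xs
insertAt [] (suc i) v = v ∷ []
insertAt (x ∷ xs) (suc i) v = x ∷ insertAt xs i v

length-insertAt : ∀ xs i v → i ≤ length xs → length (insertAt xs i v) ≡ suc (length xs)
length-insertAt xs zero v _ = refl
length-insertAt (x ∷ xs) (suc i) v (s≤s i≤) = cong suc (length-insertAt xs i v i≤)

insertAt-!-< : ∀ xs i v p → i ≤ length xs → p < i → insertAt xs i v ! p ≡ xs ! p
insertAt-!-< (x ∷ xs) (suc i) v zero _ _ = refl
insertAt-!-< (x ∷ xs) (suc i) v (suc p) (s≤s i≤) (s<s p<i) = insertAt-!-< xs i v p i≤ p<i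

insertAt-!-≡ : ∀ xs i v → i ≤ length xs → insertAt xs i v ! i ≡ v
insertAt-!-≡ xs zero v _ = refl
insertAt-!-≡ (x ∷ xs) (suc i) v (s≤s i≤) = insertAt-!-≡ xs i v i≤

insertAt-!-> : ∀ xs i v p → i ≤ length xs → i < p → insertAt xs i v ! p ≡ xs ! pred p
insertAt-!-> xs zero v (suc p) _ _ = refl
insertAt-!-> (x ∷ xs) (suc i) v (suc (suc p)) (s≤s i≤) (s<s i<p) = insertAt-!-> xs i v (suc p) i≤ i<p

!-∈ : ∀ xs p → p < length xs → xs ! p ∈ xs
!-∈ (x ∷ xs) zero _ = here refl
!-∈ (x ∷ xs) (suc p) (s<s p<) = there (!-∈ xs p p<)

∈⇒! : ∀ {v} xs → v ∈ xs → ∃ λ p → p < length xs × xs ! p ≡ v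
∈⇒! (x ∷ xs) (here refl) = 0 , s≤s z≤n , refl
∈⇒! (x ∷ xs) (there v∈) with ∈⇒! xs v∈
... | p , p< , eq = suc p , s<s p< , eq

!-beyond : ∀ xs p → length xs ≤ p → xs ! p ≡ 0
!-beyond [] p _ = refl
!-beyond (x ∷ xs) (suc p) (s≤s ≤p) = !-beyond xs p ≤p

!-ext : ∀ (xs ys : List ℕ) → length xs ≡ length ys → (∀ p → p < length xs → xs ! p ≡ ys ! p) → xs ≡ ys
!-ext [] [] _ _ = refl
!-ext (x ∷ xs) (y ∷ ys) eq pointwise =
  cong₂ _∷_ (pointwise 0 (s≤s z≤n)) (!-ext xs ys (suc-injective eq) (λ p p< → pointwise (suc p) (s<s p<)))

positionOf : ℕ → List ℕ → ℕ
positionOf v [] = 0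
positionOf v (x ∷ xs) with x ≟ v
... | yes _ = 0
... | no _ = suc (positionOf v xs)

delete : ℕ → List ℕ → List ℕ
delete v [] = []
delete v (x ∷ xs) with x ≟ v
... | yes _ = xs
... | no _ = x ∷ delete v xs

insertAt-delete : ∀ v xs → v ∈ xs → insertAt (delete v xs) (positionOf v xs) v ≡ xs
insertAt-delete v (x ∷ xs) v∈ with x ≟ v
... | yes refl = refl
insertAt-delete v (x ∷ xs) (here refl) | no x≢v = ⊥-elim (x≢v refl)
insertAt-delete v (x ∷ xs) (there v∈) | no x≢v with delete v xs | positionOf v xs | insertAt-delete v xs v∈
... | d | zero | eq = cong (x ∷_) eq
... | [] | suc k | eq = cong (x ∷_) eq
... | y ∷ d | suc k | eq = cong (x ∷_) eq

positionOf≤length-delete : ∀ v xs → v ∈ xs → positionOf v xs ≤ length (delete v xs)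
positionOf≤length-delete v (x ∷ xs) v∈ with x ≟ v
... | yes refl = z≤n
positionOf≤length-delete v (x ∷ xs) (here refl) | no x≢v = ⊥-elim (x≢v refl)
positionOf≤length-delete v (x ∷ xs) (there v∈) | no x≢v = s≤s (positionOf≤length-delete v xs v∈)

delete-insertAt : ∀ v xs i → v ∉ xs → i ≤ length xs →
  delete v (insertAt xs i v) ≡ xs × positionOf v (insertAt xs i v) ≡ i
delete-insertAt v xs zero v∉ _ with v ≟ v
... | yes _ = refl , refl
... | no v≢v = ⊥-elim (v≢v refl)
delete-insertAt v (x ∷ xs) (suc i) v∉ (s≤s i≤) with x ≟ v
... | yes refl = ⊥-elim (v∉ (here refl))
... | no _ with delete-insertAt v xs i (v∉ ∘ there) i≤
... | eq₁ , eq₂ = cong (x ∷_) eq₁ , cong suc eq₂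

runFrom : ℕ → List ℕ → ℕ
runFrom l [] = 0
runFrom l (x ∷ xs) with l <? x
... | yes _ = suc (runFrom x xs)
... | no _ = 0

run : List ℕ → ℕ
run = runFrom 0

runFrom≤length : ∀ l xs → runFrom l xs ≤ length xs
runFrom≤length l [] = z≤n
runFrom≤length l (x ∷ xs) with l <? x
... | yes _ = s≤s (runFrom≤length x xs)
... | no _ = z≤n

runFrom-< : ∀ l xs p → p < runFrom l xs → (l ∷ xs) ! p < xs ! p
runFrom-< l (x ∷ xs) p p< with l <? x
runFrom-< l (x ∷ xs) zero p< | yes l<x = l<x
runFrom-< l (x ∷ xs) (suc p) (s<s p<) | yes l<x = runFrom-< x xs p p<
runFrom-< l (x ∷ xs) p () | no _

runFrom-stop : ∀ l xs → runFrom l xs < length xs → xs ! runFrom l xs ≤ (l ∷ xs) ! runFrom l xs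
runFrom-stop l (x ∷ xs) r< with l <? x
... | yes l<x = runFrom-stop x xs (s<s⁻¹ r<)
... | no l≮x = ≮⇒≥ l≮x

runFrom-suc : ∀ l x xs → l < x → runFrom l (x ∷ xs) ≡ suc (runFrom x xs)
runFrom-suc l x xs l<x with l <? x
... | yes _ = refl
... | no l≮x = ⊥-elim (l≮x l<x)

runFrom-zero : ∀ l x xs → ¬ (l < x) → runFrom l (x ∷ xs) ≡ 0
runFrom-zero l x xs l≮x with l <? x
... | yes l<x = ⊥-elim (l≮x l<x)
... | no _ = refl

run-increasing : ∀ xs i → i ≤ run xs → ∀ p q → p < q → q < i → xs ! p < xs ! q
run-increasing xs i i≤ p (suc q) (s≤s p≤q) q<i with m≤n⇒m<n∨m≡n p≤q
... | inj₂ refl = runFrom-< 0 xs (suc p) (<-≤-trans q<i i≤)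
... | inj₁ p<q = <-trans (run-increasing xs i i≤ p q p<q (<-trans (n<1+n q) q<i))
                         (runFrom-< 0 xs (suc q) (<-≤-trans q<i i≤))

-- 213-avoiding permutations as lists

Avoids213 : ℕ → List ℕ → Set
Avoids213 n L = ∀ p q r → p < q → q < r → r < n → L ! q < L ! p → L ! p < L ! r → ⊥

record IsAv213 (n : ℕ) (L : List ℕ) : Set where
  field
    length≡ : length L ≡ n
    positive : ∀ p → p < n → 1 ≤ L ! p
    bounded : ∀ p → p < n → L ! p ≤ n
    injective : ∀ p q → p < n → q < n → L ! p ≡ L ! q → p ≡ q
    avoids : Avoids213 n L

punchIn : ℕ → ℕ → ℕ
punchIn k p with p <? k
... | yes _ = p
... | no _ = suc p

punchOut : ℕ → ℕ → ℕ
punchOut k p with p <? k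
... | yes _ = p
... | no _ = pred p

punchIn≢ : ∀ k p → punchIn k p ≢ k
punchIn≢ k p with p <? k
... | yes p<k = <⇒≢ p<k
... | no p≮k = λ eq → p≮k (subst (p <_) eq (n<1+n p))

punchOut-punchIn : ∀ k p → punchOut k (punchIn k p) ≡ p
punchOut-punchIn k p with p <? k
... | yes p<k with p <? k
...   | yes _ = refl
...   | no p≮k = ⊥-elim (p≮k p<k)
punchOut-punchIn k p | no p≮k with suc p <? k
... | yes 1+p<k = ⊥-elim (p≮k (<-trans (n<1+n p) 1+p<k))
... | no _ = refl

punchIn-< : ∀ k p n → p < n → punchIn k p < suc n
punchIn-< k p n p<n with p <? k
... | yes _ = <-trans p<n (n<1+n n)
... | no _ = s<s p<n

punchIn-mono : ∀ k p q → p < q → punchIn k p < punchIn k q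
punchIn-mono k p q p<q with p <? k | q <? k
... | yes _ | yes _ = p<q
... | yes _ | no _ = <-trans p<q (n<1+n q)
... | no p≮k | yes q<k = ⊥-elim (p≮k (<-trans p<q q<k))
... | no _ | no _ = s<s p<q

punchOut-mono : ∀ k p q → p < q → p ≢ k → q ≢ k → punchOut k p < punchOut k q
punchOut-mono k p q p<q p≢k q≢k with p <? k | q <? k
... | yes _ | yes _ = p<q
... | yes p<k | no q≮k = <-≤-trans p<k (<⇒≤pred (≤∧≢⇒< (≮⇒≥ q≮k) (q≢k ∘ sym)))
... | no p≮k | yes q<k = ⊥-elim (p≮k (<-trans p<q q<k))
... | no p≮k | no q≮k with ≤∧≢⇒< (≮⇒≥ p≮k) (p≢k ∘ sym)
... | s≤s _ = pred-mono-< p<q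

punchOut-injective : ∀ k p q → p ≢ k → q ≢ k → punchOut k p ≡ punchOut k q → p ≡ q
punchOut-injective k p q p≢k q≢k eq with <-cmp p q
... | tri< p<q _ _ = ⊥-elim (<-irrefl eq (punchOut-mono k p q p<q p≢k q≢k))
... | tri≈ _ p≡q _ = p≡q
... | tri> _ _ q<p = ⊥-elim (<-irrefl (sym eq) (punchOut-mono k q p q<p q≢k p≢k))

insertAt-!-punchOut : ∀ σ k v p → k ≤ length σ → p ≢ k → p < suc (length σ) →
  insertAt σ k v ! p ≡ σ ! punchOut k p × punchOut k p < length σ
insertAt-!-punchOut σ k v p k≤ p≢k p< with p <? k
... | yes p<k = insertAt-!-< σ k v p k≤ p<k , <-≤-trans p<k k≤
... | no p≮k with ≤∧≢⇒< (≮⇒≥ p≮k) (p≢k ∘ sym)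
... | k<p@(s≤s _) = insertAt-!-> σ k v p k≤ k<p , s<s⁻¹ p<

insertAt-!-punchIn : ∀ σ k v p → k ≤ length σ → p < length σ → insertAt σ k v ! punchIn k p ≡ σ ! p
insertAt-!-punchIn σ k v p k≤ p< =
  trans (proj₁ (insertAt-!-punchOut σ k v (punchIn k p) k≤ (punchIn≢ k p) (punchIn-< k p (length σ) p<)))
        (cong (σ !_) (punchOut-punchIn k p))

run-descent : ∀ xs → 1 ≤ xs ! 0 → run xs < length xs → ∃ λ r → suc r ≡ run xs × xs ! suc r ≤ xs ! r
run-descent (x ∷ xs) 1≤x r< =
  runFrom x xs , sym eq , subst (λ r → (x ∷ xs) ! r ≤ (0 ∷ x ∷ xs) ! r) eq (runFrom-stop 0 (x ∷ xs) r<)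
  where eq = runFrom-suc 0 x xs 1≤x

module _ {n : ℕ} {σ : List ℕ} {k : ℕ} (σ-av : IsAv213 n σ) where
  private
    module σ = IsAv213 σ-av
    π = insertAt σ k (suc n)

    entry-away : k ≤ length σ → ∀ p → p ≢ k → p < suc n → π ! p ≡ σ ! punchOut k p × punchOut k p < n
    entry-away k≤ p p≢k p< with insertAt-!-punchOut σ k (suc n) p k≤ p≢k (subst (λ m → p < suc m) (sym σ.length≡) p<)
    ... | eq , p'< = eq , subst (punchOut k p <_) σ.length≡ p'<

    entry-away-< : k ≤ length σ → ∀ p → p ≢ k → p < suc n → π ! p < suc n
    entry-away-< k≤ p p≢k p< with entry-away k≤ p p≢k p<
    ... | eq , p'< = subst (_< suc n) (sym eq) (s≤s (σ.bounded _ p'<))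

    entry-≤ : k ≤ length σ → ∀ p → p < suc n → π ! p ≤ suc n
    entry-≤ k≤ p p< with p ≟ k
    ... | yes refl = ≤-reflexive (insertAt-!-≡ σ k (suc n) k≤)
    ... | no p≢k = <⇒≤ (entry-away-< k≤ p p≢k p<)

    avoids : k ≤ run σ → k ≤ length σ → Avoids213 (suc n) π
    avoids k≤run k≤ p q r p<q q<r r< πq<πp πp<πr with p ≟ k | q ≟ k | r ≟ k
    ... | _ | yes refl | _ =
      <-irrefl refl (<-≤-trans (subst (_< π ! p) (insertAt-!-≡ σ k (suc n) k≤) πq<πp)
                               (entry-≤ k≤ p (<-trans p<q (<-trans q<r r<))))
    ... | yes refl | no _ | _ =
      <-irrefl refl (<-≤-trans (subst (_< π ! r) (insertAt-!-≡ σ k (suc n) k≤) πp<πr) (entry-≤ k≤ r r<))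
    ... | no _ | no _ | yes refl =
      <-asym πq<πp (subst₂ _<_ (sym (insertAt-!-< σ k (suc n) p k≤ (<-trans p<q q<r)))
                               (sym (insertAt-!-< σ k (suc n) q k≤ q<r))
                               (run-increasing σ k k≤run p q p<q q<r))
    ... | no p≢k | no q≢k | no r≢k
      with entry-away k≤ p p≢k (<-trans p<q (<-trans q<r r<)) | entry-away k≤ q q≢k (<-trans q<r r<)
         | entry-away k≤ r r≢k r<
    ... | eq-p , _ | eq-q , _ | eq-r , r'< =
      σ.avoids _ _ _ (punchOut-mono k p q p<q p≢k q≢k) (punchOut-mono k q r q<r q≢k r≢k) r'<
        (subst₂ _<_ eq-q eq-p πq<πp) (subst₂ _<_ eq-p eq-r πp<πr)

    injective : k ≤ length σ → ∀ p q → p < suc n → q < suc n → π ! p ≡ π ! q → p ≡ q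
    injective k≤ p q p< q< πp≡πq with p ≟ k | q ≟ k
    ... | yes refl | yes refl = refl
    ... | yes refl | no q≢k =
      ⊥-elim (<-irrefl (trans (sym πp≡πq) (insertAt-!-≡ σ k (suc n) k≤)) (entry-away-< k≤ q q≢k q<))
    ... | no p≢k | yes refl =
      ⊥-elim (<-irrefl (trans πp≡πq (insertAt-!-≡ σ k (suc n) k≤)) (entry-away-< k≤ p p≢k p<))
    ... | no p≢k | no q≢k with entry-away k≤ p p≢k p< | entry-away k≤ q q≢k q<
    ... | eq-p , p'< | eq-q , q'< =
      punchOut-injective k p q p≢k q≢k (σ.injective _ _ p'< q'< (trans (sym eq-p) (trans πp≡πq eq-q)))

    positive : k ≤ length σ → ∀ p → p < suc n → 1 ≤ π ! p
    positive k≤ p p< with p ≟ k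
    ... | yes refl = subst (1 ≤_) (sym (insertAt-!-≡ σ k (suc n) k≤)) (s≤s z≤n)
    ... | no p≢k with entry-away k≤ p p≢k p<
    ... | eq , p'< = subst (1 ≤_) (sym eq) (σ.positive _ p'<)

  insertMax-IsAv213 : k ≤ run σ → IsAv213 (suc n) π
  insertMax-IsAv213 k≤run = record
    { length≡ = trans (length-insertAt σ k (suc n) k≤) (cong suc σ.length≡)
    ; positive = positive k≤
    ; bounded = entry-≤ k≤
    ; injective = injective k≤
    ; avoids = avoids k≤run k≤
    }
    where k≤ = ≤-trans k≤run (runFrom≤length 0 σ)

  -- A 213 through the new maximum needs a descent before it.
  insertMax-run : k ≤ length σ → Avoids213 (suc n) π → k ≤ run σ
  insertMax-run k≤ π-avoids with k ≤? run σ
  ... | yes k≤run = k≤run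
  ... | no k≰run with run-descent σ (σ.positive 0 0<n) (<-≤-trans (≰⇒> k≰run) k≤)
    where 0<n = <-≤-trans (≤-<-trans z≤n (≰⇒> k≰run)) (subst (k ≤_) σ.length≡ k≤)
  ... | r , 1+r≡run , σr+1≤σr = ⊥-elim (π-avoids r (suc r) k (n<1+n r) r+1<k k<1+n πr+1<πr πr<πk)
    where
    r+1<k = subst (_< k) (sym 1+r≡run) (≰⇒> k≰run)
    r+1<n = <-≤-trans r+1<k (subst (k ≤_) σ.length≡ k≤)
    k<1+n = s≤s (subst (k ≤_) σ.length≡ k≤)
    σr+1≢σr : σ ! suc r ≢ σ ! r
    σr+1≢σr eq = 1+n≢n (σ.injective _ _ r+1<n (<-trans (n<1+n r) r+1<n) eq)
    πr+1<πr : π ! suc r < π ! r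
    πr+1<πr = subst₂ _<_ (sym (insertAt-!-< σ k (suc n) (suc r) k≤ r+1<k))
                         (sym (insertAt-!-< σ k (suc n) r k≤ (<-trans (n<1+n r) r+1<k)))
                         (≤∧≢⇒< σr+1≤σr σr+1≢σr)
    πr<πk : π ! r < π ! k
    πr<πk = subst₂ _<_ (sym (insertAt-!-< σ k (suc n) r k≤ (<-trans (n<1+n r) r+1<k)))
                       (sym (insertAt-!-≡ σ k (suc n) k≤))
                       (s≤s (σ.bounded r (<-trans (n<1+n r) r+1<n)))

module _ {n σ k} (k≤ : k ≤ length σ) (π-av : IsAv213 (suc n) (insertAt σ k (suc n))) where
  private
    module π = IsAv213 π-av
    π = insertAt σ k (suc n)

    length≡ : length σ ≡ n
    length≡ = suc-injective (trans (sym (length-insertAt σ k (suc n) k≤)) π.length≡)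

    punchIn-<′ : ∀ {p} → p < n → punchIn k p < suc n
    punchIn-<′ {p} = punchIn-< k p n

    entry : ∀ {p} → p < n → π ! punchIn k p ≡ σ ! p
    entry {p} p< = insertAt-!-punchIn σ k (suc n) p k≤ (subst (p <_) (sym length≡) p<)

    bounded : ∀ p → p < n → σ ! p ≤ n
    bounded p p< with m≤n⇒m<n∨m≡n (subst (_≤ suc n) (entry p<) (π.bounded _ (punchIn-<′ p<)))
    ... | inj₁ σp<1+n = s≤s⁻¹ σp<1+n
    ... | inj₂ σp≡1+n = ⊥-elim (punchIn≢ k p (π.injective _ _ (punchIn-<′ p<) (s≤s (subst (k ≤_) length≡ k≤))
                          (trans (entry p<) (trans σp≡1+n (sym (insertAt-!-≡ σ k (suc n) k≤))))))

  deleteMax-IsAv213 : IsAv213 n σ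
  deleteMax-IsAv213 = record
    { length≡ = length≡
    ; positive = λ p p< → subst (1 ≤_) (entry p<) (π.positive _ (punchIn-<′ p<))
    ; bounded = bounded
    ; injective = λ p q p< q< σp≡σq →
        trans (sym (punchOut-punchIn k p))
          (trans (cong (punchOut k) (π.injective _ _ (punchIn-<′ p<) (punchIn-<′ q<)
                                       (trans (entry p<) (trans σp≡σq (sym (entry q<))))))
                 (punchOut-punchIn k q))
    ; avoids = λ p q r p<q q<r r< σq<σp σp<σr →
        π.avoids _ _ _ (punchIn-mono k p q p<q) (punchIn-mono k q r q<r) (punchIn-<′ r<)
          (subst₂ _<_ (sym (entry (<-trans q<r r<))) (sym (entry (<-trans p<q (<-trans q<r r<)))) σq<σp)
          (subst₂ _<_ (sym (entry (<-trans p<q (<-trans q<r r<)))) (sym (entry r<)) σp<σr)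
    }

  deleteMax-run : k ≤ run σ
  deleteMax-run = insertMax-run deleteMax-IsAv213 k≤ π.avoids

-- The enumeration Av213 of Defs, read as lists of heights

oneLine : ∀ {m k} → Vec (Fin m) k → List ℕ
oneLine []ᵥ = []
oneLine (x ∷ᵥ w) = suc (toℕ x) ∷ oneLine w

-- Opaque, so that unification never unfolds the enumeration of all words.
opaque
  Av : ℕ → List (List ℕ)
  Av n = map oneLine (Av213 n)

length-oneLine : ∀ {m k} (w : Vec (Fin m) k) → length (oneLine w) ≡ k
length-oneLine []ᵥ = refl
length-oneLine (x ∷ᵥ w) = cong suc (length-oneLine w)

oneLine-!-toℕ : ∀ {m k} (w : Vec (Fin m) k) (i : Fin k) → oneLine w ! toℕ i ≡ suc (toℕ (Vec.lookup w i))
oneLine-!-toℕ (x ∷ᵥ w) zero = refl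
oneLine-!-toℕ (x ∷ᵥ w) (suc i) = oneLine-!-toℕ w i

oneLine-! : ∀ {n} (w : Word n) p (p< : p < n) → oneLine w ! p ≡ val w (fromℕ< p<)
oneLine-! w p p< = trans (cong (oneLine w !_) (sym (toℕ-fromℕ< p<))) (oneLine-!-toℕ w (fromℕ< p<))

oneLine-injective : ∀ {m k} {v w : Vec (Fin m) k} → oneLine v ≡ oneLine w → v ≡ w
oneLine-injective {v = []ᵥ} {[]ᵥ} _ = refl
oneLine-injective {v = x ∷ᵥ v} {y ∷ᵥ w} eq with ∷-injective eq
... | x≡y , v≡w = cong₂ _∷ᵥ_ (toℕ-injective (suc-injective x≡y)) (oneLine-injective v≡w)

allWords≡cartesianProduct : ∀ n k →
  allWords n (suc k) ≡ cartesianProductWith _∷ᵥ_ (allFin n) (allWords n k)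
allWords≡cartesianProduct n k = go (allFin n)
  where
  go : ∀ xs → concatMap (λ x → map (x ∷ᵥ_) (allWords n k)) xs ≡ cartesianProductWith _∷ᵥ_ xs (allWords n k)
  go [] = refl
  go (x ∷ xs) = cong (map (x ∷ᵥ_) (allWords n k) ++_) (go xs)

allWords-complete : ∀ n k (w : Vec (Fin n) k) → w ∈ allWords n k
allWords-complete n zero []ᵥ = here refl
allWords-complete n (suc k) (x ∷ᵥ w) rewrite allWords≡cartesianProduct n k =
  ∈-cartesianProductWith⁺ _∷ᵥ_ (∈-allFin x) (allWords-complete n k w)

allWords-unique : ∀ n k → Unique (allWords n k)
allWords-unique n zero = [] ∷ []
allWords-unique n (suc k) rewrite allWords≡cartesianProduct n k =
  Unique.cartesianProductWith⁺ _∷ᵥ_ Vec.∷-injective (Unique.allFin⁺ n) (allWords-unique n k)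

opaque
  unfolding Av

  Av-unique : ∀ n → Unique (Av n)
  Av-unique n = Unique.map⁺ oneLine-injective (Unique.filter⁺ _ (allWords-unique n n))

private
  implication⁻ : ∀ {a b} → T (not a ∨ b) → T a → T b
  implication⁻ {true} b _ = b

  implication⁺ : ∀ {a b} → (T a → T b) → T (not a ∨ b)
  implication⁺ {false} _ = _
  implication⁺ {true} a⇒b = a⇒b _

  T-not⁻ : ∀ {b} → T (not b) → ¬ T b
  T-not⁻ {false} _ ()

  T-not⁺ : ∀ {b} → ¬ T b → T (not b)
  T-not⁺ {false} _ = _
  T-not⁺ {true} ¬t = ¬t _

module _ {n} (w : Word n) where

  isPerm⁻ : T (isPerm w) → ∀ i j → val w i ≡ val w j → i ≡ j
  isPerm⁻ perm i j eq = toℕ-injective (≡ᵇ⇒≡ _ _ (implication⁻ cell (≡⇒≡ᵇ _ _ eq)))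
    where
    cell = All.lookup (all⁺ _ (allFin n) (All.lookup (all⁺ _ (allFin n) perm) (∈-allFin i))) (∈-allFin j)

  isPerm⁺ : (∀ i j → val w i ≡ val w j → i ≡ j) → T (isPerm w)
  isPerm⁺ inj = all⁻ _ {xs = allFin n} (All.tabulate λ {i} _ → all⁻ _ {xs = allFin n} (All.tabulate λ {j} _ →
    implication⁺ λ eq → ≡⇒≡ᵇ _ _ (cong toℕ (inj i j (≡ᵇ⇒≡ _ _ eq)))))

  Is213 : Fin n → Fin n → Fin n → Set
  Is213 p q r = toℕ p < toℕ q × toℕ q < toℕ r × val w q < val w p × val w p < val w r

  contains213⁺ : ∀ {p q r} → Is213 p q r → T (contains213 w)
  contains213⁺ {p} {q} {r} (p<q , q<r , wq<wp , wp<wr) =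
    any⁺ _ (lose (∈-allFin p) (any⁺ _ (lose (∈-allFin q) (any⁺ _ (lose (∈-allFin r)
      (Equivalence.from T-∧ (<⇒<ᵇ p<q , Equivalence.from T-∧ (<⇒<ᵇ q<r ,
         Equivalence.from T-∧ (<⇒<ᵇ wq<wp , <⇒<ᵇ wp<wr)))))))))

  contains213⁻ : T (contains213 w) → ∃ λ p → ∃ λ q → ∃ λ r → Is213 p q r
  contains213⁻ t with Any.satisfied (any⁻ _ (allFin n) t)
  ... | p , tp with Any.satisfied (any⁻ _ (allFin n) tp)
  ... | q , tq with Any.satisfied (any⁻ _ (allFin n) tq)
  ... | r , tr with Equivalence.to T-∧ tr
  ... | p<q , t₁ with Equivalence.to T-∧ t₁
  ... | q<r , t₂ with Equivalence.to T-∧ t₂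
  ... | wq<wp , wp<wr = p , q , r , <ᵇ⇒< _ _ p<q , <ᵇ⇒< _ _ q<r , <ᵇ⇒< _ _ wq<wp , <ᵇ⇒< _ _ wp<wr

  flags⇒IsAv213 : T (isPerm w ∧ not (contains213 w)) → IsAv213 n (oneLine w)
  flags⇒IsAv213 flags = record
    { length≡ = length-oneLine w
    ; positive = λ p p< → subst (1 ≤_) (sym (oneLine-! w p p<)) (s≤s z≤n)
    ; bounded = λ p p< → subst (_≤ n) (sym (oneLine-! w p p<)) (toℕ<n _)
    ; injective = λ p q p< q< eq →
        trans (sym (toℕ-fromℕ< p<))
          (trans (cong toℕ (isPerm⁻ perm _ _ (trans (sym (oneLine-! w p p<)) (trans eq (oneLine-! w q q<)))))
                 (toℕ-fromℕ< q<))
    ; avoids = λ p q r p<q q<r r< wq<wp wp<wr →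
        let q< = <-trans q<r r< ; p< = <-trans p<q q< in
        T-not⁻ no213 (contains213⁺ {fromℕ< p<} {fromℕ< q<} {fromℕ< r<}
          ( subst₂ _<_ (sym (toℕ-fromℕ< p<)) (sym (toℕ-fromℕ< q<)) p<q
          , subst₂ _<_ (sym (toℕ-fromℕ< q<)) (sym (toℕ-fromℕ< r<)) q<r
          , subst₂ _<_ (oneLine-! w q q<) (oneLine-! w p p<) wq<wp
          , subst₂ _<_ (oneLine-! w p p<) (oneLine-! w r r<) wp<wr ))
    }
    where
    perm = proj₁ (Equivalence.to T-∧ flags)
    no213 = proj₂ (Equivalence.to (T-∧ {isPerm w}) flags)

  IsAv213⇒flags : IsAv213 n (oneLine w) → T (isPerm w ∧ not (contains213 w))
  IsAv213⇒flags av = Equivalence.from T-∧ (isPerm⁺ injective , T-not⁺ no213)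
    where
    module av = IsAv213 av
    injective : ∀ i j → val w i ≡ val w j → i ≡ j
    injective i j eq = toℕ-injective (av.injective _ _ (toℕ<n i) (toℕ<n j)
      (trans (oneLine-!-toℕ w i) (trans eq (sym (oneLine-!-toℕ w j)))))
    no213 : ¬ T (contains213 w)
    no213 t with contains213⁻ t
    ... | p , q , r , p<q , q<r , wq<wp , wp<wr =
      av.avoids _ _ _ p<q q<r (toℕ<n r)
        (subst₂ _<_ (sym (oneLine-!-toℕ w q)) (sym (oneLine-!-toℕ w p)) wq<wp)
        (subst₂ _<_ (sym (oneLine-!-toℕ w p)) (sym (oneLine-!-toℕ w r)) wp<wr)

private
  pred-< : ∀ {x n} → 1 ≤ x → x ≤ n → pred x < n
  pred-< (s≤s _) x≤n = x≤n

  suc-pred-positive : ∀ {x} → 1 ≤ x → suc (pred x) ≡ x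
  suc-pred-positive 1≤x = suc-pred _ {{>-nonZero 1≤x}}

IsAv213⇒oneLine : ∀ {n L} → IsAv213 n L → ∃ λ (w : Word n) → oneLine w ≡ L
IsAv213⇒oneLine {n} {L} av = w , !-ext _ _ (trans (length-oneLine w) (sym av.length≡)) entries
  where
  module av = IsAv213 av
  w : Word n
  w = Vec.tabulate λ i → fromℕ< (pred-< (av.positive _ (toℕ<n i)) (av.bounded _ (toℕ<n i)))
  entry : ∀ i → oneLine w ! toℕ i ≡ L ! toℕ i
  entry i = begin
    oneLine w ! toℕ i                     ≡⟨ oneLine-!-toℕ w i ⟩
    suc (toℕ (Vec.lookup w i))            ≡⟨ cong (suc ∘ toℕ) (Vec.lookup∘tabulate _ i) ⟩
    suc (toℕ (fromℕ< _))                  ≡⟨ cong suc (toℕ-fromℕ< _) ⟩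
    suc (pred (L ! toℕ i))                ≡⟨ suc-pred-positive (av.positive _ (toℕ<n i)) ⟩
    L ! toℕ i                             ∎
    where open ≡-Reasoning
  entries : ∀ p → p < length (oneLine w) → oneLine w ! p ≡ L ! p
  entries p p< = subst (λ q → oneLine w ! q ≡ L ! q) (toℕ-fromℕ< p<n) (entry (fromℕ< p<n))
    where p<n = subst (p <_) (length-oneLine w) p<

opaque
  unfolding Av

  Av-sound : ∀ n {L} → L ∈ Av n → IsAv213 n L
  Av-sound n L∈ with ∈-map⁻ oneLine L∈
  ... | w , w∈ , refl = flags⇒IsAv213 w (proj₂ (∈-filter⁻ _ {xs = allWords n n} w∈))

  Av-complete : ∀ n {L} → IsAv213 n L → L ∈ Av n
  Av-complete n av with IsAv213⇒oneLine av
  ... | w , refl = ∈-map⁺ oneLine (∈-filter⁺ _ (allWords-complete n n w) (IsAv213⇒flags w av))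

max∈ : ∀ {n L} → IsAv213 (suc n) L → suc n ∈ L
max∈ {n} {L} av with suc n ∈? L
... | yes max∈L = max∈L
... | no max∉L = ⊥-elim (collision (pigeonhole (n<1+n n) below))
  where
  module av = IsAv213 av
  below-max : ∀ p → p < suc n → pred (L ! p) < n
  below-max p p< with m≤n⇒m<n∨m≡n (av.bounded p p<)
  ... | inj₁ Lp<1+n = pred-< (av.positive p p<) (s≤s⁻¹ Lp<1+n)
  ... | inj₂ Lp≡1+n = ⊥-elim (max∉L (subst (_∈ L) Lp≡1+n (!-∈ L p (subst (p <_) (sym av.length≡) p<))))
  below : Fin (suc n) → Fin n
  below i = fromℕ< (below-max (toℕ i) (toℕ<n i))
  collision : (∃ λ i → ∃ λ j → toℕ i < toℕ j × below i ≡ below j) → ⊥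
  collision (i , j , i<j , eq) = <-irrefl (av.injective _ _ (toℕ<n i) (toℕ<n j) (begin
    L ! toℕ i                     ≡⟨ suc-pred-positive (av.positive _ (toℕ<n i)) ⟨
    suc (pred (L ! toℕ i))        ≡⟨ cong suc (toℕ-fromℕ< _) ⟨
    suc (toℕ (below i))           ≡⟨ cong (suc ∘ toℕ) eq ⟩
    suc (toℕ (below j))           ≡⟨ cong suc (toℕ-fromℕ< _) ⟩
    suc (pred (L ! toℕ j))        ≡⟨ suc-pred-positive (av.positive _ (toℕ<n j)) ⟩
    L ! toℕ j                     ∎)) i<j
    where open ≡-Reasoning

-- The generating tree: inserting the maximum into the initial increasing run

∑-applyUpTo : (f : A → ℕ) (g : ℕ → A) (m : ℕ) → ∑ f (applyUpTo g m) ≡ ∑[ j < m ] f (g j)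
∑-applyUpTo f g zero = refl
∑-applyUpTo f g (suc m) = cong (f (g 0) +_) (∑-applyUpTo f (g ∘ suc) m)

pairsBelow : (A → ℕ) → List A → List (A × ℕ)
pairsBelow m = concatMap λ x → applyUpTo (x ,_) (m x)

module _ (m : A → ℕ) where

  ∈-pairsBelow⁺ : ∀ {xs x i} → x ∈ xs → i < m x → (x , i) ∈ pairsBelow m xs
  ∈-pairsBelow⁺ x∈ i< = ∈-concatMap⁺ _ (Any.map (λ { refl → ∈-applyUpTo⁺ _ i< }) x∈)

  ∈-pairsBelow⁻ : ∀ {xs x i} → (x , i) ∈ pairsBelow m xs → x ∈ xs × i < m x
  ∈-pairsBelow⁻ {x ∷ xs} xi∈ with ∈-++⁻ (applyUpTo (x ,_) (m x)) xi∈
  ... | inj₁ xi∈₁ with ∈-applyUpTo⁻ _ xi∈₁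
  ...   | _ , i< , refl = here refl , i<
  ∈-pairsBelow⁻ {x ∷ xs} xi∈ | inj₂ xi∈₂ = map₁ there (∈-pairsBelow⁻ xi∈₂)

  pairsBelow-unique : ∀ {xs} → Unique xs → Unique (pairsBelow m xs)
  pairsBelow-unique {[]} [] = []
  pairsBelow-unique {x ∷ xs} (x∉ ∷ xs!) =
    Unique.++⁺ (Unique.applyUpTo⁺₁ _ (m x) λ i<j _ eq → <⇒≢ i<j (cong proj₂ eq))
               (pairsBelow-unique xs!)
               disjoint
    where
    disjoint : ∀ {v} → ¬ (v ∈ applyUpTo (x ,_) (m x) × v ∈ pairsBelow m xs)
    disjoint (v∈₁ , v∈₂) with ∈-applyUpTo⁻ _ v∈₁
    ... | _ , _ , refl = All.lookup x∉ (proj₁ (∈-pairsBelow⁻ v∈₂)) refl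

  ∑-pairsBelow : (f : A × ℕ → ℕ) (xs : List A) → ∑ f (pairsBelow m xs) ≡ ∑ (λ x → ∑[ i < m x ] f (x , i)) xs
  ∑-pairsBelow f xs =
    trans (∑-concatMap f _ xs) (∑-cong xs λ {x} _ → ∑-applyUpTo f (x ,_) (m x))

∑-Av-suc : ∀ n (h : List ℕ → ℕ) →
  ∑ h (Av (suc n)) ≡ ∑ (λ σ → ∑[ i < suc (run σ) ] h (insertAt σ i (suc n))) (Av n)
∑-Av-suc n h =
  trans (∑-bijection (Av-unique (suc n)) (pairsBelow-unique children (Av-unique n))
                     split (uncurry insertMax) split∈ insertMax∈ insertMax∘split split∘insertMax h)
        (∑-pairsBelow children (h ∘ uncurry insertMax) (Av n))
  where
  children : List ℕ → ℕ
  children σ = suc (run σ)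
  insertMax : List ℕ → ℕ → List ℕ
  insertMax σ i = insertAt σ i (suc n)
  split : List ℕ → List ℕ × ℕ
  split π = delete (suc n) π , positionOf (suc n) π
  insertMax∘split : ∀ {π} → π ∈ Av (suc n) → uncurry insertMax (split π) ≡ π
  insertMax∘split π∈ = insertAt-delete (suc n) _ (max∈ (Av-sound (suc n) π∈))
  split∈ : ∀ {π} → π ∈ Av (suc n) → split π ∈ pairsBelow children (Av n)
  split∈ {π} π∈ = ∈-pairsBelow⁺ children (Av-complete n (deleteMax-IsAv213 k≤ π-av)) (s≤s (deleteMax-run k≤ π-av))
    where
    k≤ = positionOf≤length-delete (suc n) π (max∈ (Av-sound (suc n) π∈))
    π-av = subst (IsAv213 (suc n)) (sym (insertMax∘split π∈)) (Av-sound (suc n) π∈)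
  insertMax∈ : ∀ {σi} → σi ∈ pairsBelow children (Av n) → uncurry insertMax σi ∈ Av (suc n)
  insertMax∈ σi∈ with ∈-pairsBelow⁻ children σi∈
  ... | σ∈ , i< = Av-complete (suc n) (insertMax-IsAv213 (Av-sound n σ∈) (s≤s⁻¹ i<))
  split∘insertMax : ∀ {σi} → σi ∈ pairsBelow children (Av n) → split (uncurry insertMax σi) ≡ σi
  split∘insertMax {σ , i} σi∈ with ∈-pairsBelow⁻ children σi∈
  ... | σ∈ , i< with delete-insertAt (suc n) σ i max∉σ (≤-trans (s≤s⁻¹ i<) (runFrom≤length 0 σ))
    where
    max∉σ : suc n ∉ σ
    max∉σ max∈σ with ∈⇒! σ max∈σ
    ... | p , p< , eq = <-irrefl eq (s≤s (IsAv213.bounded (Av-sound n σ∈) p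
                                            (subst (p <_) (IsAv213.length≡ (Av-sound n σ∈)) p<)))
  ... | eq₁ , eq₂ = cong₂ _,_ eq₁ eq₂

-- Degrees in the grid graph

⟦_⟧ : Bool → ℕ
⟦ true ⟧ = 1
⟦ false ⟧ = 0

length-filterᵇ : (p : A → Bool) (xs : List A) → length (filterᵇ p xs) ≡ ∑ (⟦_⟧ ∘ p) xs
length-filterᵇ p [] = refl
length-filterᵇ p (x ∷ xs) with p x
... | true = cong suc (length-filterᵇ p xs)
... | false = length-filterᵇ p xs

∑<-cong : ∀ m {f g : ℕ → ℕ} → (∀ j → j < m → f j ≡ g j) → ∑< m f ≡ ∑< m g
∑<-cong zero f≗g = refl
∑<-cong (suc m) f≗g = cong₂ _+_ (f≗g 0 (s≤s z≤n)) (∑<-cong m λ j j< → f≗g (suc j) (s<s j<))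

∑<-zero : ∀ m → ∑[ j < m ] 0 ≡ 0
∑<-zero zero = refl
∑<-zero (suc m) = ∑<-zero m

∑<-+ : ∀ m (f g : ℕ → ℕ) → ∑[ j < m ] (f j + g j) ≡ ∑< m f + ∑< m g
∑<-+ zero f g = refl
∑<-+ (suc m) f g = trans (cong (f 0 + g 0 +_) (∑<-+ m (f ∘ suc) (g ∘ suc)))
                         (interchange (f 0) (g 0) (∑< m (f ∘ suc)) (∑< m (g ∘ suc)))

∑<-*ˡ : ∀ m a (f : ℕ → ℕ) → ∑[ j < m ] (a * f j) ≡ a * ∑< m f
∑<-*ˡ zero a f = sym (*-zeroʳ a)
∑<-*ˡ (suc m) a f = trans (cong (a * f 0 +_) (∑<-*ˡ m a (f ∘ suc))) (sym (*-distribˡ-+ a (f 0) _))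

∑<-last : ∀ m (f : ℕ → ℕ) → ∑< (suc m) f ≡ ∑< m f + f m
∑<-last zero f = +-comm (f 0) 0
∑<-last (suc m) f = trans (cong (f 0 +_) (∑<-last m (f ∘ suc))) (sym (+-assoc (f 0) _ _))

∑<-δ : ∀ m d (f : ℕ → ℕ) → ∑[ c < m ] (⟦ c ≡ᵇ d ⟧ * f c) ≡ ⟦ d <ᵇ m ⟧ * f d
∑<-δ zero d f = refl
∑<-δ (suc m) zero f = trans (cong (f 0 + 0 +_) (∑<-zero m)) (+-identityʳ (f 0 + 0))
∑<-δ (suc m) (suc d) f = ∑<-δ m d (f ∘ suc)

<⇒<ᵇ′ : ∀ {a b} → a < b → (a <ᵇ b) ≡ true
<⇒<ᵇ′ a<b = Equivalence.to T-≡ (<⇒<ᵇ a<b)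

≡⇒≡ᵇ′ : ∀ a → (a ≡ᵇ a) ≡ true
≡⇒≡ᵇ′ a = Equivalence.to T-≡ (≡⇒≡ᵇ a a refl)

≢⇒≡ᵇ≡false : ∀ {a b} → a ≢ b → (a ≡ᵇ b) ≡ false
≢⇒≡ᵇ≡false {a} {b} a≢b = Equivalence.to T-not-≡ (T-not⁺ (a≢b ∘ ≡ᵇ⇒≡ a b))

≮⇒<ᵇ≡false : ∀ {a b} → ¬ a < b → (a <ᵇ b) ≡ false
≮⇒<ᵇ≡false {a} {b} a≮b = Equivalence.to T-not-≡ (T-not⁺ (a≮b ∘ <ᵇ⇒< a b))

∑-tabulate : ∀ n (g : Fin n → A) (f : A → ℕ) (F : ℕ → ℕ) → (∀ i → f (g i) ≡ F (toℕ i)) →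
  ∑ f (List.tabulate g) ≡ ∑< n F
∑-tabulate zero g f F eq = refl
∑-tabulate (suc n) g f F eq = cong₂ _+_ (eq zero) (∑-tabulate n (g ∘ suc) f (F ∘ suc) (eq ∘ suc))

≡ᵇ-sym : ∀ a b → (a ≡ᵇ b) ≡ (b ≡ᵇ a)
≡ᵇ-sym zero zero = refl
≡ᵇ-sym zero (suc b) = refl
≡ᵇ-sym (suc a) zero = refl
≡ᵇ-sym (suc a) (suc b) = ≡ᵇ-sym a b

adjacentℕ : ℕ × ℕ → ℕ × ℕ → Bool
adjacentℕ (c , j) (c' , j') = ((c ≡ᵇ c') ∧ (∣ j - j' ∣ ≡ᵇ 1)) ∨ ((∣ c - c' ∣ ≡ᵇ 1) ∧ (j ≡ᵇ j'))

adjacency-split : ∀ c c' j m →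
  ⟦ adjacentℕ (c , j) (c' , m) ⟧ ≡ ⟦ c ≡ᵇ c' ⟧ * ⟦ ∣ j - m ∣ ≡ᵇ 1 ⟧ + (⟦ c' ≡ᵇ suc c ⟧ + ⟦ c ≡ᵇ suc c' ⟧) * ⟦ j ≡ᵇ m ⟧
adjacency-split zero zero j m with ∣ j - m ∣ ≡ᵇ 1
... | true = refl
... | false = refl
adjacency-split zero (suc zero) j m = sym (+-identityʳ _)
adjacency-split zero (suc (suc c')) j m = refl
adjacency-split (suc zero) zero j m = sym (+-identityʳ _)
adjacency-split (suc (suc c)) zero j m = refl
adjacency-split (suc c) (suc c') j m = adjacency-split c c' j m

vertical-neighbours : ∀ j h → suc j ≤ h → ∑[ j' < h ] ⟦ ∣ j - j' ∣ ≡ᵇ 1 ⟧ ≡ ⟦ 1 ≤ᵇ j ⟧ + ⟦ suc (suc j) ≤ᵇ h ⟧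
vertical-neighbours zero h _ =
  trans (∑<-cong h λ j' _ → sym (*-identityʳ _)) (trans (∑<-δ h 1 (λ _ → 1)) (*-identityʳ _))
vertical-neighbours (suc j) (suc h) (s≤s j<h) = begin
  ⟦ j ≡ᵇ 0 ⟧ + ∑[ j' < h ] ⟦ ∣ j - j' ∣ ≡ᵇ 1 ⟧          ≡⟨ cong (⟦ j ≡ᵇ 0 ⟧ +_) (vertical-neighbours j h j<h) ⟩
  ⟦ j ≡ᵇ 0 ⟧ + (⟦ 1 ≤ᵇ j ⟧ + ⟦ suc (suc j) ≤ᵇ h ⟧)     ≡⟨ +-assoc ⟦ j ≡ᵇ 0 ⟧ _ _ ⟨
  ⟦ j ≡ᵇ 0 ⟧ + ⟦ 1 ≤ᵇ j ⟧ + ⟦ suc (suc j) ≤ᵇ h ⟧       ≡⟨ cong (_+ ⟦ suc (suc j) ≤ᵇ h ⟧) (boundary j) ⟩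
  1 + ⟦ suc (suc j) ≤ᵇ h ⟧                           ∎
  where
  open ≡-Reasoning
  boundary : ∀ j → ⟦ j ≡ᵇ 0 ⟧ + ⟦ 1 ≤ᵇ j ⟧ ≡ 1
  boundary zero = refl
  boundary (suc j) = refl

horizontal-neighbours : ∀ j h → ∑[ j' < h ] ⟦ suc j ≡ᵇ suc j' ⟧ ≡ ⟦ suc j ≤ᵇ h ⟧
horizontal-neighbours j h =
  trans (∑<-cong h λ j' _ → sym (trans (cong (λ b → ⟦ b ⟧ * 1) (≡ᵇ-sym j' j)) (*-identityʳ _)))
        (trans (∑<-δ h j (λ _ → 1)) (*-identityʳ _))

column-neighbours : ∀ c j c' h' →
  ∑[ j' < h' ] ⟦ adjacentℕ (c , j) (c' , suc j') ⟧
    ≡ ⟦ c' ≡ᵇ c ⟧ * ∑[ j' < h' ] ⟦ ∣ j - suc j' ∣ ≡ᵇ 1 ⟧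
      + ⟦ c' ≡ᵇ suc c ⟧ * ∑[ j' < h' ] ⟦ j ≡ᵇ suc j' ⟧
      + ⟦ c ≡ᵇ suc c' ⟧ * ∑[ j' < h' ] ⟦ j ≡ᵇ suc j' ⟧
column-neighbours c j c' h' = begin
  ∑[ j' < h' ] ⟦ adjacentℕ (c , j) (c' , suc j') ⟧
    ≡⟨ ∑<-cong h' (λ j' _ → adjacency-split c c' j (suc j')) ⟩
  ∑[ j' < h' ] (a * ⟦ ∣ j - suc j' ∣ ≡ᵇ 1 ⟧ + b * ⟦ j ≡ᵇ suc j' ⟧)
    ≡⟨ ∑<-+ h' _ _ ⟩
  ∑[ j' < h' ] (a * ⟦ ∣ j - suc j' ∣ ≡ᵇ 1 ⟧) + ∑[ j' < h' ] (b * ⟦ j ≡ᵇ suc j' ⟧)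
    ≡⟨ cong₂ _+_ (∑<-*ˡ h' a _) (∑<-*ˡ h' b _) ⟩
  a * X + b * Y
    ≡⟨ cong₂ _+_ (cong (λ e → ⟦ e ⟧ * X) (≡ᵇ-sym c c')) (*-distribʳ-+ Y ⟦ c' ≡ᵇ suc c ⟧ ⟦ c ≡ᵇ suc c' ⟧) ⟩
  ⟦ c' ≡ᵇ c ⟧ * X + (⟦ c' ≡ᵇ suc c ⟧ * Y + ⟦ c ≡ᵇ suc c' ⟧ * Y)
    ≡⟨ +-assoc (⟦ c' ≡ᵇ c ⟧ * X) _ _ ⟨
  ⟦ c' ≡ᵇ c ⟧ * X + ⟦ c' ≡ᵇ suc c ⟧ * Y + ⟦ c ≡ᵇ suc c' ⟧ * Y ∎
  where
  open ≡-Reasoning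
  a = ⟦ c ≡ᵇ c' ⟧
  b = ⟦ c' ≡ᵇ suc c ⟧ + ⟦ c ≡ᵇ suc c' ⟧
  X = ∑[ j' < h' ] ⟦ ∣ j - suc j' ∣ ≡ᵇ 1 ⟧
  Y = ∑[ j' < h' ] ⟦ j ≡ᵇ suc j' ⟧

-- degree of the cell at height j of a column of height h whose neighbouring columns have heights l and r
cellDegree : ℕ → ℕ → ℕ → ℕ → ℕ
cellDegree l h r j = ⟦ 2 ≤ᵇ j ⟧ + ⟦ suc j ≤ᵇ h ⟧ + ⟦ j ≤ᵇ r ⟧ + ⟦ j ≤ᵇ l ⟧

neighbourCount : List ℕ → ℕ → ℕ × ℕ → ℕ
neighbourCount H n v = ∑[ c' < n ] ∑[ j' < H ! c' ] ⟦ adjacentℕ v (c' , suc j') ⟧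

neighbourCount≡cellDegree : ∀ H n c j → length H ≡ n → c < n → suc j ≤ H ! c →
  neighbourCount H n (c , suc j) ≡ cellDegree ((0 ∷ H) ! c) (H ! c) (H ! suc c) (suc j)
neighbourCount≡cellDegree H n c j len c<n j<h = begin
  neighbourCount H n (c , suc j)
    ≡⟨ ∑<-cong n (λ c' _ → column-neighbours c (suc j) c' (H ! c')) ⟩
  ∑[ c' < n ] (P c' + Q c' + R c')
    ≡⟨ trans (∑<-+ n _ R) (cong (_+ ∑< n R) (∑<-+ n P Q)) ⟩
  ∑< n P + ∑< n Q + ∑< n R
    ≡⟨ cong₂ _+_ (cong₂ _+_ same-column right-column) (left-column c c<n) ⟩
  cellDegree ((0 ∷ H) ! c) (H ! c) (H ! suc c) (suc j) ∎
  where
  open ≡-Reasoning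
  X Y : ℕ → ℕ
  X c' = ∑[ j' < H ! c' ] ⟦ ∣ suc j - suc j' ∣ ≡ᵇ 1 ⟧
  Y c' = ∑[ j' < H ! c' ] ⟦ suc j ≡ᵇ suc j' ⟧
  P Q R : ℕ → ℕ
  P c' = ⟦ c' ≡ᵇ c ⟧ * X c'
  Q c' = ⟦ c' ≡ᵇ suc c ⟧ * Y c'
  R c' = ⟦ c ≡ᵇ suc c' ⟧ * Y c'
  same-column : ∑< n P ≡ ⟦ 2 ≤ᵇ suc j ⟧ + ⟦ suc (suc j) ≤ᵇ H ! c ⟧
  same-column = begin
    ∑< n P                 ≡⟨ ∑<-δ n c X ⟩
    ⟦ c <ᵇ n ⟧ * X c       ≡⟨ cong (λ b → ⟦ b ⟧ * X c) (<⇒<ᵇ′ c<n) ⟩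
    X c + 0                ≡⟨ +-identityʳ (X c) ⟩
    X c                    ≡⟨ vertical-neighbours j (H ! c) j<h ⟩
    ⟦ 1 ≤ᵇ j ⟧ + ⟦ suc (suc j) ≤ᵇ H ! c ⟧ ∎
  right-column : ∑< n Q ≡ ⟦ suc j ≤ᵇ H ! suc c ⟧
  right-column with suc c <? n
  ... | yes 1+c<n = trans (∑<-δ n (suc c) Y)
                      (trans (cong (λ b → ⟦ b ⟧ * Y (suc c)) (<⇒<ᵇ′ 1+c<n))
                        (trans (+-identityʳ _) (horizontal-neighbours j (H ! suc c))))
  ... | no 1+c≮n = trans (∑<-δ n (suc c) Y) (trans (cong (λ b → ⟦ b ⟧ * Y (suc c)) (≮⇒<ᵇ≡false 1+c≮n))
                      (cong (λ h → ⟦ suc j ≤ᵇ h ⟧) (sym (!-beyond H (suc c) (subst (_≤ suc c) (sym len) (≮⇒≥ 1+c≮n))))))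
  left-column : ∀ c₀ → c₀ < n → ∑[ c' < n ] (⟦ c₀ ≡ᵇ suc c' ⟧ * Y c') ≡ ⟦ suc j ≤ᵇ (0 ∷ H) ! c₀ ⟧
  left-column zero _ = ∑<-zero n
  left-column (suc c) 1+c<n = begin
    ∑[ c' < n ] (⟦ c ≡ᵇ c' ⟧ * Y c')   ≡⟨ ∑<-cong n (λ c' _ → cong (λ b → ⟦ b ⟧ * Y c') (≡ᵇ-sym c c')) ⟩
    ∑[ c' < n ] (⟦ c' ≡ᵇ c ⟧ * Y c')   ≡⟨ ∑<-δ n c Y ⟩
    ⟦ c <ᵇ n ⟧ * Y c                   ≡⟨ cong (λ b → ⟦ b ⟧ * Y c) (<⇒<ᵇ′ (<-trans (n<1+n c) 1+c<n)) ⟩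
    Y c + 0                            ≡⟨ +-identityʳ (Y c) ⟩
    Y c                                ≡⟨ horizontal-neighbours j (H ! c) ⟩
    ⟦ suc j ≤ᵇ H ! c ⟧                 ∎

columnLeaves : ℕ → ℕ → ℕ → ℕ
columnLeaves l h r = ∑[ j < h ] ⟦ cellDegree l h r (suc j) ≡ᵇ 1 ⟧

leavesFrom : ℕ → List ℕ → ℕ
leavesFrom l [] = 0
leavesFrom l (x ∷ xs) = columnLeaves l x (xs ! 0) + leavesFrom x xs

gridLeaves : List ℕ → ℕ
gridLeaves = leavesFrom 0

leavesFrom≡∑ : ∀ l H → ∑[ c < length H ] columnLeaves ((l ∷ H) ! c) (H ! c) (H ! suc c) ≡ leavesFrom l H
leavesFrom≡∑ l [] = refl
leavesFrom≡∑ l (x ∷ xs) = cong (columnLeaves l x (xs ! 0) +_) (leavesFrom≡∑ x xs)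

∑-vertices : ∀ {n} (w : Word n) (F : Vertex n → ℕ) (K : ℕ → ℕ → ℕ) → (∀ i j → F (i , j) ≡ K (toℕ i) j) →
  ∑ F (vertices w) ≡ ∑[ c < n ] ∑[ j < oneLine w ! c ] K c (suc j)
∑-vertices {n} w F K F≡K =
  trans (∑-concatMap F (λ i → applyUpTo (λ j → i , suc j) (val w i)) (allFin n))
        (∑-tabulate n id _ _ λ i → begin
          ∑ F (applyUpTo (λ j → i , suc j) (val w i))   ≡⟨ ∑-applyUpTo F (λ j → i , suc j) (val w i) ⟩
          ∑[ j < val w i ] F (i , suc j)                ≡⟨ ∑<-cong (val w i) (λ j _ → F≡K i (suc j)) ⟩
          ∑[ j < val w i ] K (toℕ i) (suc j)            ≡⟨ cong (λ h → ∑[ j < h ] K (toℕ i) (suc j)) (oneLine-!-toℕ w i) ⟨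
          ∑[ j < oneLine w ! toℕ i ] K (toℕ i) (suc j)  ∎)
  where open ≡-Reasoning

degree≡neighbourCount : ∀ {n} (w : Word n) (i : Fin n) j → degree w (i , j) ≡ neighbourCount (oneLine w) n (toℕ i , j)
degree≡neighbourCount w i j =
  trans (length-filterᵇ (adjacent (i , j)) (vertices w))
        (∑-vertices w (⟦_⟧ ∘ adjacent (i , j)) (λ c' j' → ⟦ adjacentℕ (toℕ i , j) (c' , j') ⟧) (λ _ _ → refl))

leaves≡gridLeaves : ∀ {n} (w : Word n) → leaves w ≡ gridLeaves (oneLine w)
leaves≡gridLeaves {n} w = begin
  leaves w
    ≡⟨ length-filterᵇ (λ v → degree w v ≡ᵇ 1) (vertices w) ⟩
  ∑ (λ v → ⟦ degree w v ≡ᵇ 1 ⟧) (vertices w)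
    ≡⟨ ∑-vertices w _ (λ c j → ⟦ neighbourCount H n (c , j) ≡ᵇ 1 ⟧)
                   (λ i j → cong (λ d → ⟦ d ≡ᵇ 1 ⟧) (degree≡neighbourCount w i j)) ⟩
  ∑[ c < n ] ∑[ j < H ! c ] ⟦ neighbourCount H n (c , suc j) ≡ᵇ 1 ⟧
    ≡⟨ ∑<-cong n (λ c c<n → ∑<-cong (H ! c) λ j j< →
         cong (λ d → ⟦ d ≡ᵇ 1 ⟧) (neighbourCount≡cellDegree H n c j (length-oneLine w) c<n j<)) ⟩
  ∑[ c < n ] columnLeaves ((0 ∷ H) ! c) (H ! c) (H ! suc c)
    ≡⟨ cong (λ m → ∑[ c < m ] columnLeaves ((0 ∷ H) ! c) (H ! c) (H ! suc c)) (length-oneLine w) ⟨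
  ∑[ c < length H ] columnLeaves ((0 ∷ H) ! c) (H ! c) (H ! suc c)
    ≡⟨ leavesFrom≡∑ 0 H ⟩
  gridLeaves H ∎
  where
  open ≡-Reasoning
  H = oneLine w

-- Effect on the leaves of inserting the maximum

≤⇒≤ᵇ′ : ∀ {a b} → a ≤ b → (a ≤ᵇ b) ≡ true
≤⇒≤ᵇ′ a≤b = Equivalence.to T-≡ (≤⇒≤ᵇ a≤b)

>⇒≤ᵇ≡false : ∀ {a b} → b < a → (a ≤ᵇ b) ≡ false
>⇒≤ᵇ≡false {a} {b} b<a = Equivalence.to T-not-≡ (T-not⁺ (<⇒≱ b<a ∘ ≤ᵇ⇒≤ a b))

<ᵇ-irrefl : ∀ k → (k <ᵇ k) ≡ false
<ᵇ-irrefl zero = refl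
<ᵇ-irrefl (suc k) = <ᵇ-irrefl k

columnLeaves-1-inner : ∀ l r → 1 ≤ l → 1 ≤ r → columnLeaves l 1 r ≡ 0
columnLeaves-1-inner (suc l) (suc r) _ _ = refl

columnLeaves-1-left : ∀ r → 1 ≤ r → columnLeaves 0 1 r ≡ 1
columnLeaves-1-left (suc r) _ = refl

columnLeaves-1-right : ∀ l → 1 ≤ l → columnLeaves l 1 0 ≡ 1
columnLeaves-1-right (suc l) _ = refl

-- Only the top cell of a column of height at least 2 can be a leaf.
columnLeaves-tall : ∀ l k r → (1 ≤ l ⊎ 1 ≤ r) →
  columnLeaves l (suc (suc k)) r ≡ ⟦ not (suc (suc k) ≤ᵇ l) ∧ not (suc (suc k) ≤ᵇ r) ⟧
columnLeaves-tall l k r nonempty = begin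
  columnLeaves l h r                       ≡⟨ ∑<-last (suc k) f ⟩
  f 0 + ∑< k (f ∘ suc) + f (suc k)         ≡⟨ cong₂ _+_ (cong₂ _+_ (bottom l r nonempty) middle) top ⟩
  ⟦ ⟦ h ≤ᵇ r ⟧ + ⟦ h ≤ᵇ l ⟧ ≡ᵇ 0 ⟧          ≡⟨ both-absent (h ≤ᵇ r) (h ≤ᵇ l) ⟩
  ⟦ not (h ≤ᵇ l) ∧ not (h ≤ᵇ r) ⟧           ∎
  where
  open ≡-Reasoning
  h = suc (suc k)
  f : ℕ → ℕ
  f j = ⟦ cellDegree l h r (suc j) ≡ᵇ 1 ⟧
  bottom : ∀ l r → (1 ≤ l ⊎ 1 ≤ r) → ⟦ cellDegree l h r 1 ≡ᵇ 1 ⟧ ≡ 0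
  bottom (suc l) zero _ = refl
  bottom (suc l) (suc r) _ = refl
  bottom zero (suc r) _ = refl
  bottom zero zero (inj₁ ())
  bottom zero zero (inj₂ ())
  middle : ∑< k (f ∘ suc) ≡ 0
  middle = trans (∑<-cong k interior) (∑<-zero k)
    where
    interior : ∀ j → j < k → f (suc j) ≡ 0
    interior j j<k rewrite <⇒<ᵇ′ j<k = refl
  top : f (suc k) ≡ ⟦ ⟦ h ≤ᵇ r ⟧ + ⟦ h ≤ᵇ l ⟧ ≡ᵇ 0 ⟧
  top rewrite <ᵇ-irrefl k = refl
  both-absent : ∀ a b → ⟦ ⟦ a ⟧ + ⟦ b ⟧ ≡ᵇ 0 ⟧ ≡ ⟦ not b ∧ not a ⟧
  both-absent true true = refl
  both-absent true false = refl
  both-absent false true = refl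
  both-absent false false = refl

columnLeaves-peak : ∀ l h r → 2 ≤ h → (1 ≤ l ⊎ 1 ≤ r) → l < h → r < h → columnLeaves l h r ≡ 1
columnLeaves-peak l (suc (suc k)) r (s≤s (s≤s _)) nonempty l<h r<h
  rewrite columnLeaves-tall l k r nonempty | >⇒≤ᵇ≡false l<h | >⇒≤ᵇ≡false r<h = refl

columnLeaves-under-left : ∀ l h r → 2 ≤ h → h ≤ l → columnLeaves l h r ≡ 0
columnLeaves-under-left l (suc (suc k)) r (s≤s (s≤s _)) h≤l
  rewrite columnLeaves-tall l k r (inj₁ (≤-trans (s≤s z≤n) h≤l)) | ≤⇒≤ᵇ′ h≤l = refl

columnLeaves-under-right : ∀ l h r → 2 ≤ h → h ≤ r → columnLeaves l h r ≡ 0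
columnLeaves-under-right l (suc (suc k)) r (s≤s (s≤s _)) h≤r
  rewrite columnLeaves-tall l k r (inj₂ (≤-trans (s≤s z≤n) h≤r)) | ≤⇒≤ᵇ′ h≤r with not (suc (suc k) ≤ᵇ l)
... | true = refl
... | false = refl

Within : ℕ → List ℕ → Set
Within M = All λ x → 1 ≤ x × x < M

firstIsOne : List ℕ → ℕ
firstIsOne σ = ⟦ σ ! 0 ≡ᵇ 1 ⟧

runFrom-insertAt : ∀ M l σ i → i ≤ runFrom l σ → All (_< M) σ → l < M → runFrom l (insertAt σ i M) ≡ suc i
runFrom-insertAt M l [] zero _ _ l<M = runFrom-suc l M [] l<M
runFrom-insertAt M l (x ∷ xs) zero _ (x<M ∷ _) l<M =
  trans (runFrom-suc l M (x ∷ xs) l<M) (cong suc (runFrom-zero M x xs (<-asym x<M)))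
runFrom-insertAt M l (x ∷ xs) (suc i) i< (x<M ∷ xs<M) l<M with l <? x
... | yes _ = cong suc (runFrom-insertAt M x xs i (s≤s⁻¹ i<) xs<M x<M)

one-or-more : ∀ x → 1 ≤ x → x ≡ 1 ⊎ 2 ≤ x
one-or-more (suc zero) _ = inj₁ refl
one-or-more (suc (suc x)) _ = inj₂ (s≤s (s≤s z≤n))

runFrom-positive : ∀ y ys → ⟦ 0 <ᵇ runFrom y ys ⟧ ≡ ⟦ y <ᵇ ys ! 0 ⟧
runFrom-positive y [] = refl
runFrom-positive y (z ∷ zs) with y <? z
... | yes y<z rewrite <⇒<ᵇ′ y<z = refl
... | no y≮z rewrite ≮⇒<ᵇ≡false y≮z = refl

2≤⇒1≤ : ∀ {x} → 2 ≤ x → 1 ≤ x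
2≤⇒1≤ (s≤s _) = s≤s z≤n

-- Inserting a new maximum M between x and y only changes the leaves of the columns x, M and y.
module _ {M y} (2≤M : 2 ≤ M) (y<M : y < M) (S : ℕ) where

  insertMax-after-1 : ∀ ys → 2 ≤ y → Within M ys → Linked _≢_ (y ∷ ys) →
    columnLeaves 0 1 M + (columnLeaves 1 M y + (columnLeaves M y (ys ! 0) + S))
      ≡ columnLeaves 0 1 y + (columnLeaves 1 y (ys ! 0) + S) + ⟦ 2 ≤ᵇ runFrom 1 (y ∷ ys) ⟧
  insertMax-after-1 ys 2≤y ys-in ys-linked
    rewrite columnLeaves-1-left M (2≤⇒1≤ 2≤M) | columnLeaves-peak 1 M y 2≤M (inj₁ ≤-refl) 2≤M y<M
          | columnLeaves-under-left M y (ys ! 0) 2≤y (<⇒≤ y<M) | columnLeaves-1-left y (2≤⇒1≤ 2≤y)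
          | runFrom-suc 1 y ys 2≤y | runFrom-positive y ys = rest ys ys-in ys-linked
    where
    rest : ∀ ys → Within M ys → Linked _≢_ (y ∷ ys) →
      1 + (1 + (0 + S)) ≡ 1 + (columnLeaves 1 y (ys ! 0) + S) + ⟦ y <ᵇ ys ! 0 ⟧
    rest [] _ _ rewrite columnLeaves-peak 1 y 0 2≤y (inj₁ ≤-refl) 2≤y (2≤⇒1≤ 2≤y) = sym (+-identityʳ _)
    rest (z ∷ zs) _ (y≢z ∷ _) with <-cmp y z
    ... | tri< y<z _ _ rewrite columnLeaves-under-right 1 y z 2≤y (<⇒≤ y<z) | <⇒<ᵇ′ y<z = cong suc (+-comm 1 S)
    ... | tri≈ _ y≡z _ = ⊥-elim (y≢z y≡z)
    ... | tri> _ _ z<y rewrite columnLeaves-peak 1 y z 2≤y (inj₁ ≤-refl) 2≤y z<y | >⇒≤ᵇ≡false (s≤s (<⇒≤ z<y)) =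
      sym (+-identityʳ _)

  insertMax-before-1 : ∀ l x ys → y ≡ 1 → l < x → 2 ≤ x → x < M → Within M ys →
    columnLeaves l x M + (columnLeaves x M y + (columnLeaves M y (ys ! 0) + S))
      ≡ columnLeaves l x y + (columnLeaves x y (ys ! 0) + S) + ⟦ 2 ≤ᵇ runFrom x (y ∷ ys) ⟧
  insertMax-before-1 l x ys refl l<x 2≤x x<M ys-in
    rewrite columnLeaves-under-right l x M 2≤x (<⇒≤ x<M) | columnLeaves-peak x M 1 2≤M (inj₁ (2≤⇒1≤ 2≤x)) x<M y<M
          | columnLeaves-peak l x 1 2≤x (inj₂ ≤-refl) l<x 2≤x | runFrom-zero x 1 ys (λ x<1 → <⇒≱ x<1 (2≤⇒1≤ 2≤x)) = rest ys ys-in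
    where
    rest : ∀ ys → Within M ys → 1 + (columnLeaves M 1 (ys ! 0) + S) ≡ 1 + (columnLeaves x 1 (ys ! 0) + S) + 0
    rest [] _ rewrite columnLeaves-1-right M (2≤⇒1≤ 2≤M) | columnLeaves-1-right x (2≤⇒1≤ 2≤x) = sym (+-identityʳ _)
    rest (z ∷ zs) ((1≤z , _) ∷ _)
      rewrite columnLeaves-1-inner M z (2≤⇒1≤ 2≤M) 1≤z | columnLeaves-1-inner x z (2≤⇒1≤ 2≤x) 1≤z = sym (+-identityʳ _)

  insertMax-between-tall : ∀ l x ys → 2 ≤ y → l < x → 2 ≤ x → x < M → x ≢ y → Linked _≢_ (y ∷ ys) →
    columnLeaves l x M + (columnLeaves x M y + (columnLeaves M y (ys ! 0) + S))
      ≡ columnLeaves l x y + (columnLeaves x y (ys ! 0) + S) + ⟦ 2 ≤ᵇ runFrom x (y ∷ ys) ⟧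
  insertMax-between-tall l x ys 2≤y l<x 2≤x x<M x≢y ys-linked
    rewrite columnLeaves-under-right l x M 2≤x (<⇒≤ x<M) | columnLeaves-peak x M y 2≤M (inj₁ (2≤⇒1≤ 2≤x)) x<M y<M
          | columnLeaves-under-left M y (ys ! 0) 2≤y (<⇒≤ y<M) with <-cmp x y
  ... | tri≈ _ x≡y _ = ⊥-elim (x≢y x≡y)
  ... | tri> _ _ y<x
    rewrite columnLeaves-peak l x y 2≤x (inj₂ (2≤⇒1≤ 2≤y)) l<x y<x
          | columnLeaves-under-left x y (ys ! 0) 2≤y (<⇒≤ y<x) | runFrom-zero x y ys (<-asym y<x) = sym (+-identityʳ _)
  ... | tri< x<y _ _
    rewrite columnLeaves-under-right l x y 2≤x (<⇒≤ x<y) | runFrom-suc x y ys x<y | runFrom-positive y ys = rest ys ys-linked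
    where
    rest : ∀ ys → Linked _≢_ (y ∷ ys) → 1 + S ≡ columnLeaves x y (ys ! 0) + S + ⟦ y <ᵇ ys ! 0 ⟧
    rest [] _ rewrite columnLeaves-peak x y 0 2≤y (inj₁ (2≤⇒1≤ 2≤x)) x<y (2≤⇒1≤ 2≤y) = sym (+-identityʳ _)
    rest (z ∷ zs) (y≢z ∷ _) with <-cmp y z
    ... | tri< y<z _ _ rewrite columnLeaves-under-right x y z 2≤y (<⇒≤ y<z) | <⇒<ᵇ′ y<z = +-comm 1 S
    ... | tri≈ _ y≡z _ = ⊥-elim (y≢z y≡z)
    ... | tri> _ _ z<y rewrite columnLeaves-peak x y z 2≤y (inj₁ (2≤⇒1≤ 2≤x)) x<y z<y | >⇒≤ᵇ≡false (s≤s (<⇒≤ z<y)) =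
      sym (+-identityʳ _)

insertMax-last : ∀ M l x → 2 ≤ M → 1 ≤ l → l < x → x < M →
  columnLeaves l x M + (columnLeaves x M 0 + 0) ≡ columnLeaves l x 0 + 0 + ⟦ 2 ≤ᵇ runFrom x [] ⟧
insertMax-last M (suc l) x@(suc (suc _)) 2≤M _ l<x x<M
  rewrite columnLeaves-under-right (suc l) x M (s≤s (s≤s z≤n)) (<⇒≤ x<M)
        | columnLeaves-peak x M 0 2≤M (inj₁ (s≤s z≤n)) x<M (2≤⇒1≤ 2≤M)
        | columnLeaves-peak (suc l) x 0 (s≤s (s≤s z≤n)) (inj₁ (s≤s z≤n)) l<x (s≤s z≤n) = refl
insertMax-last M (suc l) (suc zero) _ _ (s≤s ()) _

insertMax-second : ∀ M l x y ys → 2 ≤ M → l < x → 1 ≤ x → x < M → 1 ≤ y → y < M → x ≢ y →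
  Within M ys → Linked _≢_ (y ∷ ys) →
  leavesFrom l (x ∷ M ∷ y ∷ ys) ≡ leavesFrom l (x ∷ y ∷ ys) + ⟦ 2 ≤ᵇ runFrom x (y ∷ ys) ⟧
insertMax-second M l x y ys 2≤M l<x 1≤x x<M 1≤y y<M x≢y ys-in linked with one-or-more x 1≤x | one-or-more y 1≤y
... | inj₁ refl | inj₁ refl = ⊥-elim (x≢y refl)
... | inj₁ refl | inj₂ 2≤y with l | l<x
...   | zero | _ = insertMax-after-1 2≤M y<M (leavesFrom y ys) ys 2≤y ys-in linked
...   | suc _ | s≤s ()
insertMax-second M l x y ys 2≤M l<x 1≤x x<M 1≤y y<M x≢y ys-in linked | inj₂ 2≤x | inj₁ y≡1 =
  insertMax-before-1 2≤M y<M (leavesFrom y ys) l x ys y≡1 l<x 2≤x x<M ys-in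
insertMax-second M l x y ys 2≤M l<x 1≤x x<M 1≤y y<M x≢y ys-in linked | inj₂ 2≤x | inj₂ 2≤y =
  insertMax-between-tall 2≤M y<M (leavesFrom y ys) l x ys 2≤y l<x 2≤x x<M x≢y linked

leavesFrom-insertAt : ∀ M l σ i → 2 ≤ M → 1 ≤ i → i ≤ runFrom l σ → Within M σ → Linked _≢_ σ → l < M →
  (1 ≤ l ⊎ 2 ≤ length σ) → leavesFrom l (insertAt σ i M) ≡ leavesFrom l σ + ⟦ suc (suc i) ≤ᵇ runFrom l σ ⟧
leavesFrom-insertAt M l (x ∷ xs) (suc i) 2≤M _ i≤run ((1≤x , x<M) ∷ xs-in) linked l<M short with l <? x
leavesFrom-insertAt M l (x ∷ xs) (suc i) _ _ () _ _ _ _ | no _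
leavesFrom-insertAt M l (x ∷ []) (suc zero) 2≤M _ _ ((_ , x<M) ∷ _) _ _ (inj₁ 1≤l) | yes l<x =
  insertMax-last M l x 2≤M 1≤l l<x x<M
leavesFrom-insertAt M l (x ∷ []) (suc zero) _ _ _ _ _ _ (inj₂ (s≤s ())) | yes _
leavesFrom-insertAt M l (x ∷ y ∷ ys) (suc zero) 2≤M _ _ ((1≤x , x<M) ∷ (1≤y , y<M) ∷ ys-in) (x≢y ∷ linked) _ _
  | yes l<x = insertMax-second M l x y ys 2≤M l<x 1≤x x<M 1≤y y<M x≢y ys-in linked
leavesFrom-insertAt M l (x ∷ []) (suc (suc i)) _ _ (s≤s ()) _ _ _ _ | yes _
leavesFrom-insertAt M l (x ∷ y ∷ ys) (suc (suc i)) 2≤M _ i≤run ((1≤x , x<M) ∷ xs-in) (_ ∷ linked) _ _ | yes l<x =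
  trans (cong (columnLeaves l x y +_)
              (leavesFrom-insertAt M x (y ∷ ys) (suc i) 2≤M (s≤s z≤n) (s≤s⁻¹ i≤run) xs-in linked x<M (inj₁ 1≤x)))
        (sym (+-assoc (columnLeaves l x y) _ _))

insertMax-first : ∀ M x y ys → 2 ≤ M → Within M (x ∷ y ∷ ys) → Linked _≢_ (x ∷ y ∷ ys) →
  gridLeaves (M ∷ x ∷ y ∷ ys) + firstIsOne (x ∷ y ∷ ys) ≡ gridLeaves (x ∷ y ∷ ys) + ⟦ 2 ≤ᵇ run (x ∷ y ∷ ys) ⟧
insertMax-first M x y ys 2≤M ((1≤x , x<M) ∷ (1≤y , y<M) ∷ _) (x≢y ∷ _)
  rewrite columnLeaves-peak 0 M x 2≤M (inj₂ 1≤x) (2≤⇒1≤ 2≤M) x<M | runFrom-suc 0 x (y ∷ ys) 1≤x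
        | runFrom-positive x (y ∷ ys) with one-or-more x 1≤x
... | inj₁ refl with one-or-more y 1≤y
...   | inj₁ refl = ⊥-elim (x≢y refl)
...   | inj₂ 2≤y rewrite columnLeaves-1-inner M y (2≤⇒1≤ 2≤M) 1≤y | columnLeaves-1-left y 1≤y | <⇒<ᵇ′ 2≤y = refl
insertMax-first M x y ys 2≤M ((1≤x , x<M) ∷ (1≤y , y<M) ∷ _) (x≢y ∷ _) | inj₂ 2≤x@(s≤s (s≤s _))
  rewrite columnLeaves-under-left M x y 2≤x (<⇒≤ x<M) with <-cmp x y
... | tri≈ _ x≡y _ = ⊥-elim (x≢y x≡y)
... | tri> _ _ y<x rewrite columnLeaves-peak 0 x y 2≤x (inj₂ 1≤y) (2≤⇒1≤ 2≤x) y<x | >⇒≤ᵇ≡false (s≤s (<⇒≤ y<x)) = refl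
... | tri< x<y _ _ rewrite columnLeaves-under-right 0 x y 2≤x (<⇒≤ x<y) | <⇒<ᵇ′ x<y =
  trans (+-identityʳ _) (+-comm 1 (columnLeaves x y (ys ! 0) + leavesFrom y ys))

gridLeaves-insertAt : ∀ M σ i → 2 ≤ length σ → Within M σ → Linked _≢_ σ → i ≤ run σ →
  gridLeaves (insertAt σ i M) + ⟦ i ≡ᵇ 0 ⟧ * firstIsOne σ ≡ gridLeaves σ + ⟦ suc (suc i) ≤ᵇ run σ ⟧
gridLeaves-insertAt M σ@(x ∷ y ∷ ys) zero _ σ-in@((1≤x , x<M) ∷ _) linked _ =
  trans (cong (gridLeaves (M ∷ σ) +_) (+-identityʳ (firstIsOne σ)))
        (insertMax-first M x y ys (≤-trans (s≤s 1≤x) x<M) σ-in linked)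
gridLeaves-insertAt M σ@(x ∷ y ∷ ys) (suc i) 2≤len σ-in@((1≤x , x<M) ∷ _) linked i≤run =
  trans (+-identityʳ _)
        (leavesFrom-insertAt M 0 σ (suc i) (≤-trans (s≤s 1≤x) x<M) (s≤s z≤n) i≤run σ-in linked (<-trans 1≤x x<M) (inj₂ 2≤len))
gridLeaves-insertAt M (x ∷ []) i (s≤s ()) _ _ _

All-! : {P : ℕ → Set} (σ : List ℕ) → (∀ p → p < length σ → P (σ ! p)) → All P σ
All-! [] _ = []
All-! (x ∷ σ) P! = P! 0 (s≤s z≤n) ∷ All-! σ (λ p p< → P! (suc p) (s<s p<))

Linked-! : ∀ σ → (∀ p → suc p < length σ → σ ! p ≢ σ ! suc p) → Linked _≢_ σ
Linked-! [] _ = []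
Linked-! (x ∷ []) _ = [-]
Linked-! (x ∷ y ∷ σ) distinct = distinct 0 (s≤s (s≤s z≤n)) ∷ Linked-! (y ∷ σ) (λ p p< → distinct (suc p) (s<s p<))

module _ {n σ} (σ-av : IsAv213 n σ) where
  private module σ = IsAv213 σ-av

  IsAv213⇒Within : Within (suc n) σ
  IsAv213⇒Within = All-! σ λ p p< → let p<n = subst (p <_) σ.length≡ p< in σ.positive p p<n , s≤s (σ.bounded p p<n)

  IsAv213⇒Linked : Linked _≢_ σ
  IsAv213⇒Linked = Linked-! σ λ p 1+p< eq →
    let 1+p<n = subst (suc p <_) σ.length≡ 1+p< in
    1+n≢n (sym (σ.injective p (suc p) (<-trans (n<1+n p) 1+p<n) 1+p<n eq))

  run≤ : run σ ≤ n
  run≤ = subst (run σ ≤_) σ.length≡ (runFrom≤length 0 σ)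

  run-insertMax : ∀ {i} → i ≤ run σ → run (insertAt σ i (suc n)) ≡ suc i
  run-insertMax {i} i≤run = runFrom-insertAt (suc n) 0 σ i i≤run (All.map proj₂ IsAv213⇒Within) (s≤s z≤n)

  gridLeaves-insertMax : ∀ {i} → 2 ≤ n → i ≤ run σ →
    gridLeaves (insertAt σ i (suc n)) + ⟦ i ≡ᵇ 0 ⟧ * firstIsOne σ ≡ gridLeaves σ + ⟦ suc (suc i) ≤ᵇ run σ ⟧
  gridLeaves-insertMax {i} 2≤n =
    gridLeaves-insertAt (suc n) σ i (subst (2 ≤_) (sym σ.length≡) 2≤n) IsAv213⇒Within IsAv213⇒Linked

firstIsOne-insertAt-0 : ∀ σ v → 2 ≤ v → firstIsOne (insertAt σ 0 v) ≡ 0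
firstIsOne-insertAt-0 σ (suc (suc v)) _ = refl
firstIsOne-insertAt-0 σ (suc zero) (s≤s ())

firstIsOne-insertAt-suc : ∀ σ i v → 1 ≤ length σ → firstIsOne (insertAt σ (suc i) v) ≡ firstIsOne σ
firstIsOne-insertAt-suc (x ∷ σ) i v _ = refl

-- Distributions over Av n by the length of the initial run

byRun : (List ℕ → ℕ) → ℕ → ℕ → ℕ
byRun g n r = ∑ (λ σ → ⟦ run σ ≡ᵇ r ⟧ * g σ) (Av n)

fromRun : (List ℕ → ℕ) → ℕ → ℕ → ℕ
fromRun g n k = ∑ (λ σ → ⟦ k ≤ᵇ run σ ⟧ * g σ) (Av n)

one : List ℕ → ℕ
one _ = 1

count : ℕ → ℕ → ℕ
count = byRun one

<ᵇ-suc : ∀ k r → (k <ᵇ suc r) ≡ (k ≤ᵇ r)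
<ᵇ-suc zero r = refl
<ᵇ-suc (suc k) r = refl

byRun-suc : ∀ g n k → byRun g (suc n) (suc k) ≡ ∑ (λ σ → ⟦ k ≤ᵇ run σ ⟧ * g (insertAt σ k (suc n))) (Av n)
byRun-suc g n k = trans (∑-Av-suc n _) (∑-cong (Av n) λ {σ} σ∈ → begin
  ∑[ i < suc (run σ) ] (⟦ run (insertAt σ i (suc n)) ≡ᵇ suc k ⟧ * g (insertAt σ i (suc n)))
    ≡⟨ ∑<-cong (suc (run σ)) (λ i i< → cong (λ r → ⟦ r ≡ᵇ suc k ⟧ * g (insertAt σ i (suc n)))
                                            (run-insertMax (Av-sound n σ∈) (s≤s⁻¹ i<))) ⟩
  ∑[ i < suc (run σ) ] (⟦ i ≡ᵇ k ⟧ * g (insertAt σ i (suc n)))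
    ≡⟨ ∑<-δ (suc (run σ)) k (λ i → g (insertAt σ i (suc n))) ⟩
  ⟦ k <ᵇ suc (run σ) ⟧ * g (insertAt σ k (suc n))
    ≡⟨ cong (λ b → ⟦ b ⟧ * g (insertAt σ k (suc n))) (<ᵇ-suc k (run σ)) ⟩
  ⟦ k ≤ᵇ run σ ⟧ * g (insertAt σ k (suc n)) ∎)
  where open ≡-Reasoning

byRun-zero : ∀ g n → byRun g (suc n) 0 ≡ 0
byRun-zero g n = trans (∑-Av-suc n _) (∑-zero (Av n) λ {σ} σ∈ →
  trans (∑<-cong (suc (run σ)) λ i i< → cong (λ r → ⟦ r ≡ᵇ 0 ⟧ * g (insertAt σ i (suc n)))
                                           (run-insertMax (Av-sound n σ∈) (s≤s⁻¹ i<)))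
        (∑<-zero (suc (run σ))))

⟦≤ᵇ⟧-split : ∀ k r → ⟦ k ≤ᵇ r ⟧ ≡ ⟦ r ≡ᵇ k ⟧ + ⟦ suc k ≤ᵇ r ⟧
⟦≤ᵇ⟧-split zero zero = refl
⟦≤ᵇ⟧-split zero (suc r) = refl
⟦≤ᵇ⟧-split (suc k) zero = refl
⟦≤ᵇ⟧-split (suc k) (suc r) = trans (cong ⟦_⟧ (<ᵇ-suc k r)) (⟦≤ᵇ⟧-split k r)

fromRun-split : ∀ g n k → fromRun g n k ≡ byRun g n k + fromRun g n (suc k)
fromRun-split g n k =
  trans (∑-cong (Av n) λ {σ} _ → trans (cong (_* g σ) (⟦≤ᵇ⟧-split k (run σ))) (*-distribʳ-+ (g σ) ⟦ run σ ≡ᵇ k ⟧ _))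
        (∑-+ _ _ (Av n))

fromRun-beyond : ∀ g n k → n < k → fromRun g n k ≡ 0
fromRun-beyond g n k n<k = ∑-zero (Av n) λ {σ} σ∈ →
  cong (λ b → ⟦ b ⟧ * g σ) (>⇒≤ᵇ≡false (≤-<-trans (run≤ (Av-sound n σ∈)) n<k))

fromRun-0 : ∀ g n → fromRun g n 0 ≡ ∑ g (Av n)
fromRun-0 g n = ∑-cong (Av n) λ {σ} _ → +-identityʳ (g σ)

byRun-∸run : ∀ c n r → byRun (λ σ → c ∸ run σ) n r ≡ (c ∸ r) * count n r
byRun-∸run c n r = trans (∑-cong (Av n) λ {σ} _ → pointwise σ) (∑-*ˡ (c ∸ r) _ (Av n))
  where
  pointwise : ∀ σ → ⟦ run σ ≡ᵇ r ⟧ * (c ∸ run σ) ≡ (c ∸ r) * (⟦ run σ ≡ᵇ r ⟧ * 1)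
  pointwise σ with run σ ≟ r
  ... | yes refl rewrite ≡⇒≡ᵇ′ (run σ) = trans (+-identityʳ _) (sym (*-identityʳ _))
  ... | no run≢r rewrite ≢⇒≡ᵇ≡false run≢r = sym (*-zeroʳ (c ∸ r))

count-suc : ∀ n k → count (suc n) (suc k) ≡ fromRun one n k
count-suc = byRun-suc one

firstIsOne-byRun-1 : ∀ n → 1 ≤ n → byRun firstIsOne (suc n) 1 ≡ 0
firstIsOne-byRun-1 n 1≤n = trans (byRun-suc firstIsOne n 0)
  (∑-zero (Av n) λ {σ} _ → cong (1 *_) (firstIsOne-insertAt-0 σ (suc n) (s≤s 1≤n)))

firstIsOne-byRun-suc : ∀ n k → 1 ≤ n → byRun firstIsOne (suc n) (suc (suc k)) ≡ fromRun firstIsOne n (suc k)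
firstIsOne-byRun-suc n k 1≤n = trans (byRun-suc firstIsOne n (suc k)) (∑-cong (Av n) λ {σ} σ∈ →
  cong (⟦ suc k ≤ᵇ run σ ⟧ *_)
       (firstIsOne-insertAt-suc σ k (suc n) (subst (1 ≤_) (sym (IsAv213.length≡ (Av-sound n σ∈))) 1≤n)))

gridLeaves-byRun-suc : ∀ n k → 2 ≤ n →
  byRun gridLeaves (suc n) (suc k) + ⟦ k ≡ᵇ 0 ⟧ * fromRun firstIsOne n 0
    ≡ fromRun gridLeaves n k + fromRun one n (suc (suc k))
gridLeaves-byRun-suc n k 2≤n = begin
  byRun gridLeaves (suc n) (suc k) + ⟦ k ≡ᵇ 0 ⟧ * fromRun firstIsOne n 0
    ≡⟨ cong₂ _+_ (byRun-suc gridLeaves n k) (sym (∑-*ˡ ⟦ k ≡ᵇ 0 ⟧ _ (Av n))) ⟩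
  ∑ (λ σ → ⟦ k ≤ᵇ run σ ⟧ * gridLeaves (insertAt σ k (suc n))) (Av n)
    + ∑ (λ σ → ⟦ k ≡ᵇ 0 ⟧ * (⟦ 0 ≤ᵇ run σ ⟧ * firstIsOne σ)) (Av n)
    ≡⟨ ∑-+ _ _ (Av n) ⟨
  ∑ (λ σ → ⟦ k ≤ᵇ run σ ⟧ * gridLeaves (insertAt σ k (suc n)) + ⟦ k ≡ᵇ 0 ⟧ * (⟦ 0 ≤ᵇ run σ ⟧ * firstIsOne σ)) (Av n)
    ≡⟨ ∑-cong (Av n) (λ σ∈ → pointwise k _ (Av-sound n σ∈)) ⟩
  ∑ (λ σ → ⟦ k ≤ᵇ run σ ⟧ * gridLeaves σ + ⟦ suc (suc k) ≤ᵇ run σ ⟧ * 1) (Av n)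
    ≡⟨ ∑-+ _ _ (Av n) ⟩
  fromRun gridLeaves n k + fromRun one n (suc (suc k)) ∎
  where
  open ≡-Reasoning
  pointwise : ∀ k σ → IsAv213 n σ →
    ⟦ k ≤ᵇ run σ ⟧ * gridLeaves (insertAt σ k (suc n)) + ⟦ k ≡ᵇ 0 ⟧ * (⟦ 0 ≤ᵇ run σ ⟧ * firstIsOne σ)
      ≡ ⟦ k ≤ᵇ run σ ⟧ * gridLeaves σ + ⟦ suc (suc k) ≤ᵇ run σ ⟧ * 1
  pointwise k σ σ-av with k ≤? run σ
  ... | yes k≤run rewrite ≤⇒≤ᵇ′ k≤run
                        | +-identityʳ (gridLeaves (insertAt σ k (suc n))) | +-identityʳ (gridLeaves σ)
                        | +-identityʳ (firstIsOne σ) | *-identityʳ ⟦ suc (suc k) ≤ᵇ run σ ⟧ =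
    gridLeaves-insertMax σ-av 2≤n k≤run
  ... | no k≰run with k
  ...   | zero = ⊥-elim (k≰run z≤n)
  ...   | suc k′ rewrite >⇒≤ᵇ≡false (≰⇒> k≰run)
                       | >⇒≤ᵇ≡false (<-trans (≰⇒> k≰run) (<-trans (n<1+n (suc k′)) (n<1+n (suc (suc k′))))) = refl

opaque
  unfolding Av

  count-0 : count 0 0 ≡ 1
  count-0 = refl

  firstIsOne-byRun-base : ∀ r → byRun firstIsOne 1 (suc r) ≡ count 0 r
  firstIsOne-byRun-base r = refl

  gridLeaves-byRun-base : ∀ r → byRun gridLeaves 2 r ≡ count 2 r + byRun (λ σ → 2 ∸ run σ) 1 r + byRun firstIsOne 2 r
  gridLeaves-byRun-base zero = refl
  gridLeaves-byRun-base (suc zero) = refl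
  gridLeaves-byRun-base (suc (suc zero)) = refl
  gridLeaves-byRun-base (suc (suc (suc r))) = refl

-- Binomial coefficients

pascal : ∀ n k → suc n C suc k ≡ n C k + n C suc k
pascal n k = sym (nCk+nC[k+1]≡[n+1]C[k+1] n k)

absorption : ∀ n k → suc k * (suc n C suc k) ≡ suc n * (n C k)
absorption zero zero = refl
absorption zero (suc k) rewrite k>n⇒nCk≡0 {1} {suc (suc k)} (s≤s (s≤s z≤n)) = *-zeroʳ (suc (suc k))
absorption (suc n) zero = begin
  1 * (suc (suc n) C 1)       ≡⟨ *-identityˡ _ ⟩
  suc (suc n) C 1             ≡⟨ nC1≡n (suc (suc n)) ⟩
  suc (suc n)                 ≡⟨ *-identityʳ (suc (suc n)) ⟨
  suc (suc n) * 1             ∎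
  where open ≡-Reasoning
absorption (suc n) (suc k) = begin
  suc (suc k) * (suc (suc n) C suc (suc k))
    ≡⟨ cong (suc (suc k) *_) (pascal (suc n) (suc k)) ⟩
  suc (suc k) * (c + d)
    ≡⟨ lemma₁ (suc k) c d ⟩
  suc k * c + c + suc (suc k) * d
    ≡⟨ cong₂ (λ x y → x + c + y) (absorption n k) (absorption n (suc k)) ⟩
  suc n * (n C k) + c + suc n * (n C suc k)
    ≡⟨ lemma₂ (suc n) (n C k) (n C suc k) c ⟩
  suc n * ((n C k) + (n C suc k)) + c
    ≡⟨ cong (λ x → suc n * x + c) (pascal n k) ⟨
  suc n * c + c
    ≡⟨ +-comm (suc n * c) c ⟩
  suc (suc n) * (suc n C suc k) ∎
  where
  open ≡-Reasoning
  c = suc n C suc k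
  d = suc n C suc (suc k)
  lemma₁ : ∀ x c d → suc x * (c + d) ≡ x * c + c + suc x * d
  lemma₁ = solve-∀
  lemma₂ : ∀ x a b c → x * a + c + x * b ≡ x * (a + b) + c
  lemma₂ = solve-∀

ratio : ∀ n k → suc k * (n C suc k) + k * (n C k) ≡ n * (n C k)
ratio zero zero = refl
ratio zero (suc k) rewrite k>n⇒nCk≡0 {0} {suc k} (s≤s z≤n) = cong₂ _+_ (*-zeroʳ (suc (suc k))) (*-zeroʳ (suc k))
ratio (suc n) zero = trans (+-identityʳ _) (absorption n 0)
ratio (suc n) (suc k) = begin
  suc (suc k) * (suc n C suc (suc k)) + suc k * (suc n C suc k)
    ≡⟨ cong₂ _+_ (absorption n (suc k)) (absorption n k) ⟩
  suc n * (n C suc k) + suc n * (n C k)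
    ≡⟨ *-distribˡ-+ (suc n) (n C suc k) (n C k) ⟨
  suc n * ((n C suc k) + (n C k))
    ≡⟨ cong (suc n *_) (trans (+-comm (n C suc k) (n C k)) (sym (pascal n k))) ⟩
  suc n * (suc n C suc k) ∎
  where open ≡-Reasoning

catalan-difference : ∀ k x → x + (k + k) C suc k ≡ (k + k) C k → suc k * x ≡ (k + k) C k
catalan-difference k x x+b₁≡b₀ = +-cancelʳ-≡ (k * b₀) _ _ (+-cancelʳ-≡ ((k + k) * b₀) _ _ (begin
  suc k * x + k * b₀ + (k + k) * b₀
    ≡⟨ cong (suc k * x + k * b₀ +_) (ratio (k + k) k) ⟨
  suc k * x + k * b₀ + (suc k * b₁ + k * b₀)
    ≡⟨ lemma₁ (suc k) k x b₀ b₁ ⟩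
  suc k * (x + b₁) + k * b₀ + k * b₀
    ≡⟨ cong (λ y → suc k * y + k * b₀ + k * b₀) x+b₁≡b₀ ⟩
  suc k * b₀ + k * b₀ + k * b₀
    ≡⟨ lemma₂ k b₀ ⟩
  b₀ + k * b₀ + (k + k) * b₀ ∎))
  where
  open ≡-Reasoning
  b₀ = (k + k) C k
  b₁ = (k + k) C suc k
  lemma₁ : ∀ a k x b₀ b₁ → a * x + k * b₀ + (a * b₁ + k * b₀) ≡ a * (x + b₁) + k * b₀ + k * b₀
  lemma₁ = solve-∀
  lemma₂ : ∀ k b₀ → suc k * b₀ + k * b₀ + k * b₀ ≡ b₀ + k * b₀ + (k + k) * b₀
  lemma₂ = solve-∀

-- Ballot numbers

count-rec : ∀ n k → count (suc n) (suc k) ≡ count n k + count (suc n) (suc (suc k))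
count-rec n k = trans (count-suc n k) (trans (fromRun-split one n k) (cong (count n k +_) (sym (count-suc n (suc k)))))

count-diag : ∀ n → count n n ≡ 1
count-diag zero = count-0
count-diag (suc n) = trans (count-suc n n)
  (trans (fromRun-split one n n) (cong₂ _+_ (count-diag n) (fromRun-beyond one n (suc n) (n<1+n n))))

-- count (K+1) (s+1) = C(M, K) − C(M, K+1) for K = s + b and M = K + b; taking the indices as equations
-- lets each case choose convenient normal forms for them.
ballot : ∀ b s {K M} → K ≡ s + b → M ≡ K + b → count (suc K) (suc s) + M C suc K ≡ M C K
ballot zero s refl refl rewrite +-identityʳ s | +-identityʳ s =
  trans (cong₂ _+_ (count-diag (suc s)) (k>n⇒nCk≡0 (n<1+n s))) (sym (nCn≡1 s))
ballot (suc b) zero refl refl = begin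
  count (suc (suc b)) 1 + suc m C suc (suc b)
    ≡⟨ cong₂ _+_ (trans (count-rec (suc b) 0) (cong (_+ count (suc (suc b)) 2) (byRun-zero one b)))
                 (pascal m (suc b)) ⟩
  count (suc (suc b)) 2 + ((m C suc b) + (m C suc (suc b)))
    ≡⟨ lemma (count (suc (suc b)) 2) (m C suc b) (m C suc (suc b)) ⟩
  (m C suc b) + (count (suc (suc b)) 2 + (m C suc (suc b)))
    ≡⟨ cong ((m C suc b) +_) (ballot b 1 refl (+-suc b b)) ⟩
  (m C suc b) + (m C suc b)
    ≡⟨ cong (_+ (m C suc b)) (trans (nCk≡nC[n∸k] (m≤m+n b (suc b))) (cong (m C_) (m+n∸m≡n b (suc b)))) ⟨
  (m C b) + (m C suc b)
    ≡⟨ pascal m b ⟨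
  suc m C suc b ∎
  where
  open ≡-Reasoning
  m = b + suc b
  lemma : ∀ a p q → a + (p + q) ≡ p + (a + q)
  lemma = solve-∀
ballot (suc b) (suc s) refl refl = begin
  count (suc (suc K)) (suc (suc s)) + suc M C suc (suc K)
    ≡⟨ cong₂ _+_ (count-rec (suc K) (suc s)) (pascal M (suc K)) ⟩
  (count (suc K) (suc s) + count (suc (suc K)) (suc (suc (suc s)))) + ((M C suc K) + (M C suc (suc K)))
    ≡⟨ interchange (count (suc K) (suc s)) _ (M C suc K) _ ⟩
  (count (suc K) (suc s) + (M C suc K)) + (count (suc (suc K)) (suc (suc (suc s))) + (M C suc (suc K)))
    ≡⟨ cong₂ _+_ (ballot (suc b) s refl refl) (ballot b (suc (suc s)) (cong suc (+-suc s b)) (+-suc K b)) ⟩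
  (M C K) + (M C suc K)
    ≡⟨ pascal M K ⟨
  suc M C suc K ∎
  where
  open ≡-Reasoning
  K = s + suc b
  M = K + suc b

catalan-count : ∀ m → count (suc m) 1 ≡ catalan m
catalan-count m = sym (begin
  ((2 * m) C m) / suc m          ≡⟨ cong (λ t → (t C m) / suc m) (cong (m +_) (+-identityʳ m)) ⟩
  ((m + m) C m) / suc m          ≡⟨ cong (_/ suc m) (catalan-difference m c (ballot m 0 refl refl)) ⟨
  (suc m * c) / suc m            ≡⟨ cong (_/ suc m) (*-comm (suc m) c) ⟩
  (c * suc m) / suc m            ≡⟨ m*n/n≡m c (suc m) ⟩
  c                              ∎)
  where
  open ≡-Reasoning
  c = count (suc m) 1

-- Distribution of the leaves

downward-induction : (P : ℕ → Set) (n : ℕ) → (∀ k → n < k → P k) → (∀ k → k ≤ n → P (suc k) → P k) → ∀ k → P k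
downward-induction P n beyond step k = go (suc n) k (≤-trans (n<1+n n) (m≤n+m (suc n) k))
  where
  go : ∀ d k → n < k + d → P k
  go zero k n< = beyond k (subst (n <_) (+-identityʳ k) n<)
  go (suc d) k n< with n <? k
  ... | yes n<k = beyond k n<k
  ... | no n≮k = step k (≮⇒≥ n≮k) (go d (suc k) (subst (n <_) (+-suc k d) n<))

firstIsOne-byRun : ∀ m r → byRun firstIsOne (suc m) (suc r) ≡ count m r
firstIsOne-byRun zero r = firstIsOne-byRun-base r
firstIsOne-byRun (suc m) zero = trans (firstIsOne-byRun-1 (suc m) (s≤s z≤n)) (sym (byRun-zero one m))
firstIsOne-byRun (suc m) (suc k) =
  trans (firstIsOne-byRun-suc (suc m) k (s≤s z≤n)) (trans (shifted k) (sym (count-suc m k)))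
  where
  shifted : ∀ k → fromRun firstIsOne (suc m) (suc k) ≡ fromRun one m k
  shifted = downward-induction _ m
    (λ k m<k → trans (fromRun-beyond firstIsOne (suc m) (suc k) (s<s m<k)) (sym (fromRun-beyond one m k m<k)))
    (λ k _ ih → trans (fromRun-split firstIsOne (suc m) (suc k))
                  (trans (cong₂ _+_ (firstIsOne-byRun m k) ih) (sym (fromRun-split one m k))))

fromRun-linear : ∀ a b c d m → (∀ r → byRun a (suc m) r ≡ byRun b (suc m) r + byRun c m r + byRun d (suc m) r) →
  ∀ k → fromRun a (suc m) k ≡ fromRun b (suc m) k + fromRun c m k + fromRun d (suc m) k
fromRun-linear a b c d m by-r = downward-induction _ (suc m) beyond step
  where
  beyond : ∀ k → suc m < k → fromRun a (suc m) k ≡ fromRun b (suc m) k + fromRun c m k + fromRun d (suc m) k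
  beyond k m< rewrite fromRun-beyond a (suc m) k m< | fromRun-beyond b (suc m) k m<
                    | fromRun-beyond c m k (<-trans (n<1+n m) m<) | fromRun-beyond d (suc m) k m< = refl
  rearrange : ∀ x y z u v w → (x + y + z) + (u + v + w) ≡ (x + u) + (y + v) + (z + w)
  rearrange = solve-∀
  step : ∀ k → k ≤ suc m →
    fromRun a (suc m) (suc k) ≡ fromRun b (suc m) (suc k) + fromRun c m (suc k) + fromRun d (suc m) (suc k) →
    fromRun a (suc m) k ≡ fromRun b (suc m) k + fromRun c m k + fromRun d (suc m) k
  step k _ ih = begin
    fromRun a (suc m) k
      ≡⟨ fromRun-split a (suc m) k ⟩
    byRun a (suc m) k + fromRun a (suc m) (suc k)
      ≡⟨ cong₂ _+_ (by-r k) ih ⟩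
    (Eb + Ec + Ed) + (Gb + Gc + Gd)
      ≡⟨ rearrange Eb Ec Ed Gb Gc Gd ⟩
    (Eb + Gb) + (Ec + Gc) + (Ed + Gd)
      ≡⟨ cong₂ _+_ (cong₂ _+_ (fromRun-split b (suc m) k) (fromRun-split c m k)) (fromRun-split d (suc m) k) ⟨
    fromRun b (suc m) k + fromRun c m k + fromRun d (suc m) k ∎
    where
    open ≡-Reasoning
    Eb = byRun b (suc m) k
    Ec = byRun c m k
    Ed = byRun d (suc m) k
    Gb = fromRun b (suc m) (suc k)
    Gc = fromRun c m (suc k)
    Gd = fromRun d (suc m) (suc k)

slack : ℕ → List ℕ → ℕ
slack c σ = c ∸ run σ

fromRun-slack : ∀ m k → fromRun (slack (suc m)) m k + fromRun one (suc m) (suc (suc k)) ≡ byRun (slack (suc (suc m))) (suc m) (suc k)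
fromRun-slack m k = trans (downward-induction P m beyond step k) (sym (byRun-∸run (suc (suc m)) (suc m) (suc k)))
  where
  P : ℕ → Set
  P k = fromRun (slack (suc m)) m k + fromRun one (suc m) (suc (suc k)) ≡ (suc m ∸ k) * count (suc m) (suc k)
  beyond : ∀ k → m < k → P k
  beyond k m<k rewrite fromRun-beyond (slack (suc m)) m k m<k
                     | fromRun-beyond one (suc m) (suc (suc k)) (<-trans (s<s m<k) (n<1+n _)) | m≤n⇒m∸n≡0 m<k = refl
  step : ∀ k → k ≤ m → P (suc k) → P k
  step k k≤m ih = begin
    fromRun (slack (suc m)) m k + fromRun one (suc m) (suc (suc k))
      ≡⟨ cong₂ _+_ (fromRun-split (slack (suc m)) m k) (fromRun-split one (suc m) (suc (suc k))) ⟩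
    (byRun (slack (suc m)) m k + fromRun (slack (suc m)) m (suc k)) + (count (suc m) (suc (suc k)) + fromRun one (suc m) (suc (suc (suc k))))
      ≡⟨ interchange (byRun (slack (suc m)) m k) _ (count (suc m) (suc (suc k))) _ ⟩
    byRun (slack (suc m)) m k + count (suc m) (suc (suc k)) + (fromRun (slack (suc m)) m (suc k) + fromRun one (suc m) (suc (suc (suc k))))
      ≡⟨ cong₂ _+_ (cong (_+ count (suc m) (suc (suc k))) (trans (byRun-∸run (suc m) m k) (cong (_* count m k) 1+m∸k))) ih ⟩
    suc (m ∸ k) * count m k + count (suc m) (suc (suc k)) + (m ∸ k) * count (suc m) (suc (suc k))
      ≡⟨ lemma (m ∸ k) (count m k) (count (suc m) (suc (suc k))) ⟩
    suc (m ∸ k) * (count m k + count (suc m) (suc (suc k)))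
      ≡⟨ cong₂ _*_ (sym 1+m∸k) (sym (count-rec m k)) ⟩
    (suc m ∸ k) * count (suc m) (suc k) ∎
    where
    open ≡-Reasoning
    1+m∸k : suc m ∸ k ≡ suc (m ∸ k)
    1+m∸k = +-∸-assoc 1 k≤m
    lemma : ∀ d a b → suc d * a + b + d * b ≡ suc d * (a + b)
    lemma = solve-∀

gridLeaves-byRun : ∀ m → 1 ≤ m → ∀ r →
  byRun gridLeaves (suc m) r ≡ count (suc m) r + byRun (slack (suc m)) m r + byRun firstIsOne (suc m) r
gridLeaves-byRun (suc zero) _ r = gridLeaves-byRun-base r
gridLeaves-byRun (suc (suc p)) _ zero
  rewrite byRun-zero gridLeaves (suc (suc p)) | byRun-zero one (suc (suc p))
        | byRun-zero (slack (suc (suc (suc p)))) (suc p) | byRun-zero firstIsOne (suc (suc p)) = refl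
gridLeaves-byRun (suc (suc p)) _ (suc k) = +-cancelʳ-≡ X _ _ (begin
  byRun gridLeaves (suc m) (suc k) + X
    ≡⟨ gridLeaves-byRun-suc m k (s≤s (s≤s z≤n)) ⟩
  fromRun gridLeaves m k + fromRun one m (suc (suc k))
    ≡⟨ cong (_+ fromRun one m (suc (suc k)))
            (fromRun-linear gridLeaves one (slack m) firstIsOne (suc p) (gridLeaves-byRun (suc p) (s≤s z≤n)) k) ⟩
  fromRun one m k + fromRun (slack m) (suc p) k + fromRun firstIsOne m k + fromRun one m (suc (suc k))
    ≡⟨ rearrange (fromRun one m k) (fromRun (slack m) (suc p) k) (fromRun firstIsOne m k) _ ⟩
  fromRun one m k + (fromRun (slack m) (suc p) k + fromRun one m (suc (suc k))) + fromRun firstIsOne m k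
    ≡⟨ cong₂ _+_ (cong₂ _+_ (sym (count-suc m k)) (fromRun-slack (suc p) k)) (firstIsOne-fromRun k) ⟩
  count (suc m) (suc k) + byRun (slack (suc m)) m (suc k) + (byRun firstIsOne (suc m) (suc k) + X)
    ≡⟨ +-assoc (count (suc m) (suc k) + byRun (slack (suc m)) m (suc k)) _ X ⟨
  count (suc m) (suc k) + byRun (slack (suc m)) m (suc k) + byRun firstIsOne (suc m) (suc k) + X ∎)
  where
  open ≡-Reasoning
  m = suc (suc p)
  X = ⟦ k ≡ᵇ 0 ⟧ * fromRun firstIsOne m 0
  rearrange : ∀ a b c d → a + b + c + d ≡ a + (b + d) + c
  rearrange = solve-∀
  firstIsOne-fromRun : ∀ k → fromRun firstIsOne m k ≡ byRun firstIsOne (suc m) (suc k) + ⟦ k ≡ᵇ 0 ⟧ * fromRun firstIsOne m 0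
  firstIsOne-fromRun zero = sym (trans (cong (_+ (fromRun firstIsOne m 0 + 0)) (firstIsOne-byRun-1 m (s≤s z≤n)))
                                       (+-identityʳ _))
  firstIsOne-fromRun (suc k) = sym (trans (+-identityʳ _) (firstIsOne-byRun-suc m k (s≤s z≤n)))

opaque
  unfolding Av

  Q₁≡fromRun : ∀ n → Q₁ n ≡ fromRun gridLeaves n 0
  Q₁≡fromRun n = begin
    Q₁ n                                  ≡⟨ ∑-cong (Av213 n) (λ {w} _ → leaves≡gridLeaves w) ⟩
    ∑ (gridLeaves ∘ oneLine) (Av213 n)    ≡⟨ ∑-map gridLeaves oneLine (Av213 n) ⟨
    ∑ gridLeaves (Av n)                   ≡⟨ fromRun-0 gridLeaves n ⟨
    fromRun gridLeaves n 0                ∎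
    where open ≡-Reasoning

-- Q₁ n = fromRun gridLeaves n 0 enters the leaf recurrence for the children of run 1, whose leaves are known.
Q₁-count : ∀ m → Q₁ (suc (suc m)) ≡ (suc (suc m) + 2) * count (suc (suc m)) 1
Q₁-count m = trans (Q₁≡fromRun n) (+-cancelʳ-≡ t _ _ (begin
  fromRun gridLeaves n 0 + t
    ≡⟨ cong (fromRun gridLeaves n 0 +_) (count-suc n 2) ⟩
  fromRun gridLeaves n 0 + fromRun one n 2
    ≡⟨ gridLeaves-byRun-suc n 0 (s≤s (s≤s z≤n)) ⟨
  byRun gridLeaves (suc n) 1 + 1 * fromRun firstIsOne n 0
    ≡⟨ cong₂ _+_ leaves-at-1 (cong (1 *_) firstIsOne-total) ⟩
  c + t + n * c + 0 + 1 * c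
    ≡⟨ lemma c t n ⟩
  (n + 2) * c + t ∎))
  where
  open ≡-Reasoning
  n = suc (suc m)
  c = count n 1
  t = count (suc n) 3
  count-at-1 : count (suc n) 1 ≡ c + t
  count-at-1 = trans (count-rec n 0) (trans (cong (_+ count (suc n) 2) (byRun-zero one (suc m))) (count-rec n 1))
  leaves-at-1 : byRun gridLeaves (suc n) 1 ≡ c + t + n * c + 0
  leaves-at-1 = trans (gridLeaves-byRun n (s≤s z≤n) 1)
    (cong₂ _+_ (cong₂ _+_ count-at-1 (byRun-∸run (suc n) n 1)) (firstIsOne-byRun-1 n (s≤s z≤n)))
  firstIsOne-total : fromRun firstIsOne n 0 ≡ c
  firstIsOne-total = begin
    fromRun firstIsOne n 0                              ≡⟨ fromRun-split firstIsOne n 0 ⟩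
    byRun firstIsOne n 0 + fromRun firstIsOne n 1       ≡⟨ cong (_+ fromRun firstIsOne n 1) (byRun-zero firstIsOne (suc m)) ⟩
    fromRun firstIsOne n 1                              ≡⟨ firstIsOne-byRun-suc n 0 (s≤s z≤n) ⟨
    byRun firstIsOne (suc n) 2                          ≡⟨ firstIsOne-byRun n 1 ⟩
    c                                                   ∎
  lemma : ∀ c t n → c + t + n * c + 0 + 1 * c ≡ (n + 2) * c + t
  lemma = solve-∀

catalan-mul : ∀ k → suc k * catalan k ≡ (k + k) C k
catalan-mul k = trans (cong (suc k *_) (sym (catalan-count k))) (catalan-difference k _ (ballot k 0 refl refl))

odd-middle-binomial : ∀ k → suc (k + k) C k ≡ suc (k + k) * catalan k
odd-middle-binomial k = *-cancelˡ-≡ _ _ (suc k) (begin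
  suc k * (suc (k + k) C k)            ≡⟨ cong (suc k *_) symmetric ⟩
  suc k * (suc (k + k) C suc k)        ≡⟨ absorption (k + k) k ⟩
  suc (k + k) * ((k + k) C k)          ≡⟨ cong (suc (k + k) *_) (catalan-mul k) ⟨
  suc (k + k) * (suc k * catalan k)    ≡⟨ *-left-swap (suc (k + k)) (suc k) (catalan k) ⟩
  suc k * (suc (k + k) * catalan k)    ∎)
  where
  open ≡-Reasoning
  symmetric : suc (k + k) C k ≡ suc (k + k) C suc k
  symmetric = trans (nCk≡nC[n∸k] (≤-trans (m≤m+n k k) (n≤1+n _)))
                    (cong (suc (k + k) C_) (trans (+-∸-assoc 1 (m≤m+n k k)) (cong suc (m+n∸m≡n k k))))

central-binomial : ∀ k → (2 * suc k) C suc k ≡ 2 * (2 * suc k ∸ 1) * catalan k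
central-binomial k = *-cancelˡ-≡ _ _ (suc k) (begin
  suc k * ((2 * suc k) C suc k)                  ≡⟨ cong (λ t → suc k * (t C suc k)) 2+2k ⟩
  suc k * (suc (suc (k + k)) C suc k)            ≡⟨ absorption (suc (k + k)) k ⟩
  suc (suc (k + k)) * (suc (k + k) C k)          ≡⟨ cong (suc (suc (k + k)) *_) (odd-middle-binomial k) ⟩
  suc (suc (k + k)) * (suc (k + k) * catalan k)  ≡⟨ lemma k (catalan k) ⟩
  suc k * (2 * suc (k + k) * catalan k)          ≡⟨ cong (λ t → suc k * (2 * (t ∸ 1) * catalan k)) 2+2k ⟨
  suc k * (2 * (2 * suc k ∸ 1) * catalan k)      ∎)
  where
  open ≡-Reasoning
  2+2k : 2 * suc k ≡ suc (suc (k + k))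
  2+2k = cong suc (trans (+-suc k (k + 0)) (cong (λ t → suc (k + t)) (+-identityʳ k)))
  lemma : ∀ k x → suc (suc (k + k)) * (suc (k + k) * x) ≡ suc k * (2 * suc (k + k) * x)
  lemma = solve-∀

corollary6p5 : (n : ℕ) → n ≥ 2 →
    (Q₁ n ≡ (n + 2) * catalan (n ∸ 1))
    × (2 * (2 * n ∸ 1) * Q₁ n ≡ (n + 2) * ((2 * n) C n))
corollary6p5 (suc (suc m)) _ = Q₁≡ , (begin
  2 * (2 * n ∸ 1) * Q₁ n                    ≡⟨ cong (2 * (2 * n ∸ 1) *_) Q₁≡ ⟩
  2 * (2 * n ∸ 1) * ((n + 2) * catalan k)   ≡⟨ *-left-swap (2 * (2 * n ∸ 1)) (n + 2) (catalan k) ⟩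
  (n + 2) * (2 * (2 * n ∸ 1) * catalan k)   ≡⟨ cong ((n + 2) *_) (central-binomial k) ⟨
  (n + 2) * ((2 * n) C n)                   ∎)
  where
  open ≡-Reasoning
  k = suc m
  n = suc k
  Q₁≡ : Q₁ n ≡ (n + 2) * catalan k
  Q₁≡ = trans (Q₁-count m) (cong ((n + 2) *_) (catalan-count k))
corollary6p5 (suc zero) (s≤s ())
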